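{- Let $\Gamma$ be a bipartite distance-regular graph with vertex set $X$, diameter $D\ge4$ and valency $k\ge3$, and fix $x\in X$. Assume that for each $i$ with $2\le i\le D-2$ there exist complex scalars $\alpha_i,\beta_i$ such that for all $y,z\in X$ with $\partial(x,y)=2$, $\partial(x,z)=i$, $\partial(y,z)=i$, $$\alpha_i+\beta_i\,|\Gamma(x)\cap\Gamma(y)\cap\Gamma_{i-1}(z)|=|\Gamma_{i-1}(x)\cap\Gamma_{i-1}(y)\cap\Gamma(z)|.$$ Then for $2\le i\le D-2$, $$\alpha_iLR^{i-1}E_2^*=(c_i-\alpha_i)\big(R^{i-1}LE_2^*+R^{i-2}LRE_2^*+\cdots+RLR^{i-2}E_2^*\big)-c_i\beta_iR^{i-1}LE_2^*+\Big(c_ic_{i-1}(\beta_ic_2+b_i)+(\alpha_i-c_i)\sum_{j=1}^{i-1}b_{j-1}c_j\Big)R^{i-2}E_2^*,$$ where $R^{i-1}LE_2^*+\cdots+RLR^{i-2}E_2^*=\sum_{j=0}^{i-2}R^{i-1-j}LR^jE_2^*$.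
   Context: $\partial$ is path-length distance, $\Gamma_j(z)$ the set of vertices at distance $j$ from $z$, $\Gamma(z)=\Gamma_1(z)$; $c_j=|\Gamma_{j-1}(u)\cap\Gamma(w)|$, $b_j=|\Gamma_{j+1}(u)\cap\Gamma(w)|$ for $\partial(u,w)=j$. $A$ is the adjacency matrix; $E_j^*$ the diagonal matrix in $\mathrm{Mat}_X(\mathbb{C})$ with $(z,z)$-entry $1$ if $\partial(x,z)=j$, else $0$; $L=\sum_{h=1}^DE^*_{h-1}AE^*_h$, $R=\sum_{h=0}^{D-1}E^*_{h+1}AE^*_h$. -}

module Defs where

open import Level using (Level; _⊔_) renaming (suc to lsuc)
open import Data.Nat using (ℕ; zero; suc; _∸_; _≤_) renaming (_+_ to _+ℕ_)
open import Data.Bool using (Bool; true; false; _∧_; _∨_; not; if_then_else_)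
open import Data.Fin using (Fin)
open import Data.Fin.Properties using (_≟_)
open import Data.Product using (Σ; ∃; _×_; _,_)
open import Relation.Nullary using (¬_)
open import Relation.Nullary.Decidable using (⌊_⌋)
open import Relation.Binary.PropositionalEquality using (_≡_)
open import Algebra.Bundles using (CommutativeRing)

record Graph (n : ℕ) : Set where
  field
    adj     : Fin n → Fin n → Bool
    symm    : ∀ u v → adj u v ≡ adj v u
    irrefl  : ∀ u → adj u u ≡ false

anyFin : ∀ {n} → (Fin n → Bool) → Bool
anyFin {zero}  f = false
anyFin {suc n} f = f Fin.zero ∨ anyFin (λ i → f (Fin.suc i))

count : ∀ {n} → (Fin n → Bool) → ℕ
count {zero}  f = 0
count {suc n} f = (if f Fin.zero then 1 else 0) +ℕ count (λ i → f (Fin.suc i))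

module _ {n : ℕ} (G : Graph n) where
  open Graph G

  reach : ℕ → Fin n → Fin n → Bool
  reach zero    u w = ⌊ u ≟ w ⌋
  reach (suc j) u w = reach j u w ∨ anyFin (λ v → reach j u v ∧ adj v w)

  isDist : Fin n → Fin n → ℕ → Bool
  isDist u w zero    = reach zero u w
  isDist u w (suc j) = reach (suc j) u w ∧ not (reach j u w)

  Dist : Fin n → Fin n → ℕ → Set
  Dist u w j = isDist u w j ≡ true

  inΓ : ℕ → Fin n → Fin n → Bool
  inΓ j z v = isDist z v j

  Connected : Set
  Connected = ∀ u w → ∃ λ j → Dist u w j

  HasDiameter : ℕ → Set
  HasDiameter D = (∀ u w j → Dist u w j → j ≤ D)
                × (∃ λ u → ∃ λ w → Dist u w D)

  Regular : ℕ → Set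
  Regular k = ∀ u → count (inΓ 1 u) ≡ k

  Bipartite : Set
  Bipartite = Σ (Fin n → Bool) λ col → ∀ u v → adj u v ≡ true → ¬ (col u ≡ col v)

  record IsDRG (b c : ℕ → ℕ) : Set where
    field
      connected : Connected
      c-prop : ∀ j u w → Dist u w (suc j) →
               count (λ v → inΓ j u v ∧ inΓ 1 w v) ≡ c (suc j)
      b-prop : ∀ j u w → Dist u w j →
               count (λ v → inΓ (suc j) u v ∧ inΓ 1 w v) ≡ b j

-- Fields of characteristic zero (stand-in for ℂ; ℂ is one of them)

ιR : ∀ {c ℓ} (Rg : CommutativeRing c ℓ) → ℕ → CommutativeRing.Carrier Rg
ιR Rg zero    = CommutativeRing.0# Rg
ιR Rg (suc m) = CommutativeRing._+_ Rg (CommutativeRing.1# Rg) (ιR Rg m)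

record CharZeroField c ℓ : Set (lsuc (c ⊔ ℓ)) where
  field
    cring      : CommutativeRing c ℓ
  field
    nontrivial : ¬ (CommutativeRing._≈_ cring (CommutativeRing.1# cring) (CommutativeRing.0# cring))
    inverse    : ∀ a → ¬ (CommutativeRing._≈_ cring a (CommutativeRing.0# cring)) →
                 ∃ λ a⁻¹ → CommutativeRing._≈_ cring (CommutativeRing._*_ cring a a⁻¹) (CommutativeRing.1# cring)
    charZero   : ∀ m → ¬ (CommutativeRing._≈_ cring (ιR cring (suc m)) (CommutativeRing.0# cring))
  open CommutativeRing cring public
  ι : ℕ → Carrier
  ι = ιR cring

module Matrices {c ℓ} (F : CharZeroField c ℓ) where
  open CharZeroField F

  Mat : ℕ → Set c
  Mat n = Fin n → Fin n → Carrier

  sumF : ∀ {n} → (Fin n → Carrier) → Carrier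
  sumF {zero}  f = 0#
  sumF {suc n} f = f Fin.zero + sumF (λ i → f (Fin.suc i))

  _⊕_ : ∀ {n} → Mat n → Mat n → Mat n
  (M ⊕ N) u v = M u v + N u v

  _⊗_ : ∀ {n} → Mat n → Mat n → Mat n
  (M ⊗ N) u v = sumF (λ w → M u w * N w v)

  _·_ : ∀ {n} → Carrier → Mat n → Mat n
  (a · M) u v = a * M u v

  𝟎 : ∀ {n} → Mat n
  𝟎 u v = 0#

  𝟏 : ∀ {n} → Mat n
  𝟏 u v = if ⌊ u ≟ v ⌋ then 1# else 0#

  _^^_ : ∀ {n} → Mat n → ℕ → Mat n
  M ^^ zero  = 𝟏
  M ^^ suc m = M ⊗ (M ^^ m)

  sumRange : ∀ {n} → ℕ → ℕ → (ℕ → Mat n) → Mat n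
  sumRange lo zero      f = 𝟎
  sumRange lo (suc len) f = f lo ⊕ sumRange (suc lo) len f

  _≋_ : ∀ {n} → Mat n → Mat n → Set ℓ
  M ≋ N = ∀ u v → M u v ≈ N u v

  boolF : Bool → Carrier
  boolF true  = 1#
  boolF false = 0#

  module GraphMats {n : ℕ} (G : Graph n) (D : ℕ) (x : Fin n) where
    open Graph G

    A : Mat n
    A u v = boolF (adj u v)

    E* : ℕ → Mat n
    E* j u v = if ⌊ u ≟ v ⌋ then boolF (isDist G x u j) else 0#

    L : Mat n
    L = sumRange 1 D (λ h → E* (h ∸ 1) ⊗ (A ⊗ E* h))

    R : Mat n
    R = sumRange 0 D (λ h → E* (suc h) ⊗ (A ⊗ E* h))

sumℕ : ℕ → (ℕ → ℕ) → ℕ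
sumℕ zero    f = 0
sumℕ (suc m) f = sumℕ m f +ℕ f m

module Submission where

open import Defs
open import Data.Nat using (ℕ; _≤_; _∸_; suc; zero; z≤n; s≤s) renaming (_+_ to _+ℕ_; _*_ to _*ℕ_)
open import Data.Fin using (Fin)
open import Data.Bool using (_∧_)
open import Algebra.Bundles using (CommutativeRing)

-- Every matrix in the identity has entries in the image of ℕ, so it is proved entrywise over ℕ and
-- transported along ι.  With lev w = ∂(x,w), bipartiteness puts every neighbour of u one level
-- above or below u, so L u w = [u ~ w][lev w = lev u + 1] and R u w = [u ~ w][lev u = lev w + 1];
-- hence R^k u w counts the geodesics from w to u, and is c₁⋯c_k when lev u = lev w + k = lev w + ∂(w,u)
-- and 0 otherwise.  The sum S_m = Σ_{j<m} R^{m-1-j} L R^j E₂* obeys S_{m+1} = R S_m + L R^m E₂*,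
-- and counting the neighbours of u at distance m from v with the intersection numbers gives S_m
-- in closed form: for lev v = 2 and lev u = m its (u,v)-entry is c₁⋯c_m if ∂(v,u) = m and
-- c₁⋯c_{m-2} · Σ_{j ≤ m-2} b_j c_{j+1} if ∂(v,u) = m - 2.  At an entry (u,v) of the identity only three
-- situations remain: ∂(v,u) = i, where the hypothesis on α_i, β_i, read with y = v and z = u,
-- closes the computation; ∂(v,u) = i - 2, where the relevant neighbour counts are b_i and c_2; or
-- every entry vanishes.  In each case what is left is a polynomial identity in the counts.

module Walks {n : ℕ} (G : Graph n) where

  import Data.Nat as ℕ
  open import Data.Nat using (ℕ; zero; suc; _≤_; _<_; z≤n; s≤s)
  open import Data.Nat.Properties using (≤-refl; ≤-pred; m≤n⇒m≤1+n; ≤∧≢⇒<; <-cmp; ≰⇒>)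
  open import Data.Fin using (Fin; zero; suc)
  open import Data.Fin.Properties using (_≟_)
  open import Data.Bool using (Bool; true; false; _∧_; _∨_)
  open import Data.Product using (∃; _×_; _,_)
  open import Data.Sum using (_⊎_; inj₁; inj₂)
  open import Data.Empty using (⊥-elim)
  open import Relation.Nullary using (¬_; yes; no)
  open import Relation.Binary.Definitions using (tri<; tri≈; tri>)
  open import Relation.Binary.PropositionalEquality using (_≡_; refl; sym; trans)

  private
    ∨-true⁻ : ∀ a b → a ∨ b ≡ true → a ≡ true ⊎ b ≡ true
    ∨-true⁻ true  b e = inj₁ refl
    ∨-true⁻ false b e = inj₂ e

    ∨-trueˡ : ∀ a b → a ≡ true → a ∨ b ≡ true
    ∨-trueˡ true b e = refl

    ∨-trueʳ : ∀ a b → b ≡ true → a ∨ b ≡ true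
    ∨-trueʳ true  b e = refl
    ∨-trueʳ false b e = e

    ∧-true⁻ˡ : ∀ a b → a ∧ b ≡ true → a ≡ true
    ∧-true⁻ˡ true b e = refl

    ∧-true⁻ʳ : ∀ a b → a ∧ b ≡ true → b ≡ true
    ∧-true⁻ʳ true b e = e

    ∧-true : ∀ {a b} → a ≡ true → b ≡ true → a ∧ b ≡ true
    ∧-true refl refl = refl

    true≢false : ¬ true ≡ false
    true≢false ()

    ¬true⇒false : ∀ b → ¬ b ≡ true → b ≡ false
    ¬true⇒false true  f = ⊥-elim (f refl)
    ¬true⇒false false f = refl

    anyFin-true : ∀ {m} (f : Fin m → Bool) i → f i ≡ true → anyFin f ≡ true
    anyFin-true f zero    e = ∨-trueˡ (f zero) _ e
    anyFin-true f (suc i) e = ∨-trueʳ (f zero) _ (anyFin-true (λ j → f (suc j)) i e)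

    anyFin-true⁻ : ∀ {m} (f : Fin m → Bool) → anyFin f ≡ true → ∃ λ i → f i ≡ true
    anyFin-true⁻ {suc m} f e with ∨-true⁻ (f zero) _ e
    ... | inj₁ p = zero , p
    ... | inj₂ p with anyFin-true⁻ (λ j → f (suc j)) p
    ... | i , q = suc i , q

  open Graph G

  reach-refl : ∀ u → reach G 0 u u ≡ true
  reach-refl u with u ≟ u
  ... | yes _ = refl
  ... | no u≢u = ⊥-elim (u≢u refl)

  reach-zero⇒≡ : ∀ {u w} → reach G 0 u w ≡ true → u ≡ w
  reach-zero⇒≡ {u} {w} e with u ≟ w
  ... | yes u≡w = u≡w

  reach-suc : ∀ j {u w} → reach G j u w ≡ true → reach G (suc j) u w ≡ true
  reach-suc j e = ∨-trueˡ _ _ e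

  reach-mono : ∀ {j j' u w} → j ≤ j' → reach G j u w ≡ true → reach G j' u w ≡ true
  reach-mono {j} {j'} j≤j' e with j ℕ.≟ j'
  ... | yes refl = e
  ... | no j≢j' with j' | j≤j'
  ... | zero    | z≤n     = e
  ... | suc j'' | j≤1+j'' = reach-suc j'' (reach-mono (≤-pred (≤∧≢⇒< j≤1+j'' j≢j')) e)

  reach-snoc : ∀ j {u z w} → reach G j u z ≡ true → adj z w ≡ true → reach G (suc j) u w ≡ true
  reach-snoc j {u} {z} {w} e a =
    ∨-trueʳ (reach G j u w) _ (anyFin-true (λ v → reach G j u v ∧ adj v w) z (∧-true e a))

  reach-cons : ∀ j {v u w} → reach G j u w ≡ true → adj v u ≡ true → reach G (suc j) v w ≡ true
  reach-cons zero {v} e a with reach-zero⇒≡ e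
  ... | refl = reach-snoc 0 (reach-refl v) a
  reach-cons (suc j) {v} {u} {w} e a with ∨-true⁻ (reach G j u w) _ e
  ... | inj₁ p = reach-suc (suc j) (reach-cons j p a)
  ... | inj₂ p with anyFin-true⁻ (λ z → reach G j u z ∧ adj z w) p
  ... | z , q = reach-snoc (suc j) (reach-cons j (∧-true⁻ˡ _ _ q) a) (∧-true⁻ʳ (reach G j u z) _ q)

  reach-sym : ∀ j {u w} → reach G j u w ≡ true → reach G j w u ≡ true
  reach-sym zero e with reach-zero⇒≡ e
  ... | refl = e
  reach-sym (suc j) {u} {w} e with ∨-true⁻ (reach G j u w) _ e
  ... | inj₁ p = reach-suc j (reach-sym j p)
  ... | inj₂ p with anyFin-true⁻ (λ z → reach G j u z ∧ adj z w) p
  ... | z , q = reach-cons j (reach-sym j (∧-true⁻ˡ _ _ q)) (trans (symm w z) (∧-true⁻ʳ (reach G j u z) _ q))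

  Dist⇒reach : ∀ j {u w} → Dist G u w j → reach G j u w ≡ true
  Dist⇒reach zero    e = e
  Dist⇒reach (suc j) e = ∧-true⁻ˡ _ _ e

  Dist⇒¬reach : ∀ j {u w} → Dist G u w (suc j) → reach G j u w ≡ false
  Dist⇒¬reach j {u} {w} e with reach G j u w | reach G (suc j) u w
  ... | false | _    = refl
  Dist⇒¬reach j () | true | true
  Dist⇒¬reach j () | true | false

  reach⇒Dist : ∀ j {u w} → reach G (suc j) u w ≡ true → reach G j u w ≡ false → Dist G u w (suc j)
  reach⇒Dist j e f rewrite e | f = refl

  reach⇒Dist-≤ : ∀ j {u w} → reach G j u w ≡ true → ∃ λ j' → j' ≤ j × Dist G u w j'
  reach⇒Dist-≤ zero e = 0 , z≤n , e
  reach⇒Dist-≤ (suc j) {u} {w} e with reach G j u w in eq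
  ... | true  = let (j' , j'≤j , d) = reach⇒Dist-≤ j eq in j' , m≤n⇒m≤1+n j'≤j , d
  ... | false = suc j , ≤-refl , reach⇒Dist j {u} {w} (∨-trueʳ (reach G j u w) _ e) eq

  Dist⇒¬reach-< : ∀ {j j' u w} → Dist G u w j → j' < j → reach G j' u w ≡ false
  Dist⇒¬reach-< {suc j} {j'} {u} {w} d (s≤s j'≤j) with reach G j' u w in eq
  ... | false = refl
  ... | true with trans (sym (reach-mono j'≤j eq)) (Dist⇒¬reach j d)
  ... | ()

  Dist-unique : ∀ {j j' u w} → Dist G u w j → Dist G u w j' → j ≡ j'
  Dist-unique {j} {j'} d d' with <-cmp j j'
  ... | tri≈ _ j≡j' _ = j≡j'
  ... | tri< j<j' _ _ = ⊥-elim (true≢false (trans (sym (Dist⇒reach j d)) (Dist⇒¬reach-< d' j<j')))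
  ... | tri> _ _ j>j' = ⊥-elim (true≢false (trans (sym (Dist⇒reach j' d')) (Dist⇒¬reach-< d j>j')))

  Dist-sym : ∀ {j u w} → Dist G u w j → Dist G w u j
  Dist-sym {zero} e with reach-zero⇒≡ e
  ... | refl = e
  Dist-sym {suc j} e = reach⇒Dist j (reach-sym (suc j) (Dist⇒reach (suc j) e))
    (¬true⇒false _ (λ r → true≢false (trans (sym (reach-sym j r)) (Dist⇒¬reach j e))))

  Dist-pred : ∀ {j u w} → Dist G u w (suc j) → ∃ λ z → Dist G u z j × adj z w ≡ true
  Dist-pred {j} {u} {w} e with ∨-true⁻ (reach G j u w) _ (Dist⇒reach (suc j) e)
  ... | inj₁ p = ⊥-elim (true≢false (trans (sym p) (Dist⇒¬reach j e)))
  ... | inj₂ p with anyFin-true⁻ (λ z → reach G j u z ∧ adj z w) p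
  ... | z , q with reach⇒Dist-≤ j (∧-true⁻ˡ _ _ q)
  ... | j' , j'≤j , d with j' ℕ.≟ j
  ... | yes refl = z , d , ∧-true⁻ʳ (reach G j u z) _ q
  ... | no j'≢j = ⊥-elim (true≢false (trans
          (sym (reach-mono (≤∧≢⇒< j'≤j j'≢j) (reach-snoc j' (Dist⇒reach j' d) (∧-true⁻ʳ (reach G j u z) _ q))))
          (Dist⇒¬reach j e)))

  Dist-adj-≤ : ∀ {j j' u w w'} → Dist G u w j → adj w w' ≡ true → Dist G u w' j' → j' ≤ suc j
  Dist-adj-≤ {j} {j'} d a d' with j' ℕ.≤? suc j
  ... | yes j'≤1+j = j'≤1+j
  ... | no j'≰1+j = ⊥-elim (true≢false (trans (sym (reach-snoc j (Dist⇒reach j d) a))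
                                              (Dist⇒¬reach-< d' (≰⇒> j'≰1+j))))

  adj⇒Dist-1 : ∀ {u w} → adj u w ≡ true → Dist G u w 1
  adj⇒Dist-1 {u} {w} a = reach⇒Dist 0 (reach-snoc 0 (reach-refl u) a) (¬true⇒false _ loop)
    where
    loop : ¬ reach G 0 u w ≡ true
    loop r with reach-zero⇒≡ r
    ... | refl = true≢false (trans (sym a) (irrefl u))

  Dist-1⇒adj : ∀ {u w} → Dist G u w 1 → adj u w ≡ true
  Dist-1⇒adj {u} {w} d with Dist-pred {0} {u} {w} d
  ... | z , d0 , a with reach-zero⇒≡ {u} {z} d0
  ... | refl = a

module Metric {n : ℕ} (G : Graph n) (connected : Connected G) where

  open import Data.Nat using (ℕ; zero; suc; _+_; _≤_; s≤s)
  open import Data.Nat.Properties using (≤-reflexive; ≤-trans; ≤-antisym; <-cmp; +-suc; +-identityʳ)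
  open import Data.Bool using (Bool; true; false; not; _xor_)
  open import Data.Product using (∃; _×_; _,_; proj₁; proj₂)
  open import Data.Sum using (_⊎_; inj₁; inj₂)
  open import Data.Empty using (⊥-elim)
  open import Relation.Nullary using (¬_)
  open import Relation.Binary.Definitions using (tri<; tri≈; tri>)
  open import Relation.Binary.PropositionalEquality using (_≡_; refl; sym; trans; cong)

  open Graph G
  open Walks G

  dist : Fin n → Fin n → ℕ
  dist u w = proj₁ (connected u w)

  Dist-dist : ∀ u w → Dist G u w (dist u w)
  Dist-dist u w = proj₂ (connected u w)

  Dist⇒dist≡ : ∀ {u w j} → Dist G u w j → dist u w ≡ j
  Dist⇒dist≡ {u} {w} = Dist-unique {u = u} {w} (Dist-dist u w)

  dist≡⇒Dist : ∀ {u w j} → dist u w ≡ j → Dist G u w j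
  dist≡⇒Dist {u} {w} refl = Dist-dist u w

  dist-sym : ∀ u w → dist u w ≡ dist w u
  dist-sym u w = Dist⇒dist≡ {u} {w} (Dist-sym {dist w u} {w} {u} (Dist-dist w u))

  dist-refl : ∀ u → dist u u ≡ 0
  dist-refl u = Dist⇒dist≡ {u} {u} {0} (reach-refl u)

  dist≡0⇒≡ : ∀ {u w} → dist u w ≡ 0 → u ≡ w
  dist≡0⇒≡ {u} {w} e = reach-zero⇒≡ (dist≡⇒Dist {u} {w} e)

  adj⇒dist≡1 : ∀ {u w} → adj u w ≡ true → dist u w ≡ 1
  adj⇒dist≡1 {u} {w} a = Dist⇒dist≡ {u} {w} (adj⇒Dist-1 a)

  dist≡1⇒adj : ∀ {u w} → dist u w ≡ 1 → adj u w ≡ true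
  dist≡1⇒adj {u} {w} e = Dist-1⇒adj (dist≡⇒Dist {u} {w} e)

  dist-adj-≤ : ∀ {p a b} → adj a b ≡ true → dist p b ≤ suc (dist p a)
  dist-adj-≤ {p} {a} {b} a~b = Dist-adj-≤ {u = p} (Dist-dist p a) a~b (Dist-dist p b)

  dist-pred : ∀ {u w j} → dist u w ≡ suc j → ∃ λ z → dist u z ≡ j × adj z w ≡ true
  dist-pred {u} {w} {j} e with Dist-pred {j} {u} {w} (dist≡⇒Dist {u} {w} e)
  ... | z , d , a = z , Dist⇒dist≡ {u} {z} d , a

  dist-triangle : ∀ p a b → dist p b ≤ dist p a + dist a b
  dist-triangle p a b = go (dist a b) b refl
    where
    go : ∀ d b → dist a b ≡ d → dist p b ≤ dist p a + d
    go zero b e with dist≡0⇒≡ {a} {b} e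
    ... | refl = ≤-reflexive (sym (+-identityʳ _))
    go (suc d) b e with dist-pred e
    ... | z , az≡d , z~b = ≤-trans (dist-adj-≤ z~b) (≤-trans (s≤s (go d z az≡d)) (≤-reflexive (sym (+-suc _ d))))

  module _ (bipartite : Bipartite G) where
    private
      colour = proj₁ bipartite

      parity : ℕ → Bool
      parity zero    = false
      parity (suc j) = not (parity j)

      ≢⇒≡not : ∀ a b → ¬ a ≡ b → b ≡ not a
      ≢⇒≡not true  true  a≢b = ⊥-elim (a≢b refl)
      ≢⇒≡not true  false _   = refl
      ≢⇒≡not false true  _   = refl
      ≢⇒≡not false false a≢b = ⊥-elim (a≢b refl)

      xor-false : ∀ a → a ≡ a xor false
      xor-false true  = refl
      xor-false false = refl

      not-xor : ∀ a b → not (a xor b) ≡ a xor not b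
      not-xor true  b = refl
      not-xor false b = refl

      colour-dist : ∀ j p w → dist p w ≡ j → colour w ≡ colour p xor parity j
      colour-dist zero p w e with dist≡0⇒≡ {p} {w} e
      ... | refl = xor-false (colour p)
      colour-dist (suc j) p w e with dist-pred {p} {w} {j} e
      ... | z , pz≡j , z~w = trans (≢⇒≡not (colour z) (colour w) (proj₂ bipartite z w z~w))
                                   (trans (cong not (colour-dist j p z pz≡j)) (not-xor (colour p) (parity j)))

    adj⇒dist≢ : ∀ {p a b} → adj a b ≡ true → ¬ dist p a ≡ dist p b
    adj⇒dist≢ {p} {a} {b} a~b e = proj₂ bipartite a b a~b
      (trans (colour-dist _ p a refl) (trans (cong (λ j → colour p xor parity j) e) (sym (colour-dist _ p b refl))))

    adj⇒dist-step : ∀ {p a b} → adj a b ≡ true → dist p b ≡ suc (dist p a) ⊎ dist p a ≡ suc (dist p b)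
    adj⇒dist-step {p} {a} {b} a~b with <-cmp (dist p a) (dist p b)
    ... | tri≈ _ e _ = ⊥-elim (adj⇒dist≢ a~b e)
    ... | tri< lt _ _ = inj₁ (≤-antisym (dist-adj-≤ a~b) lt)
    ... | tri> _ _ gt = inj₂ (≤-antisym (dist-adj-≤ (trans (symm b a) a~b)) gt)

module Counting where

  open import Data.Nat using (ℕ; zero; suc; _+_; _*_; _≤_; _<_; s≤s)
  open import Data.Nat.Properties
  open import Data.Fin using (Fin; zero; suc)
  open import Data.Fin.Properties using () renaming (_≟_ to _≟ᶠ_)
  open import Data.Bool using (Bool; true; false; _∧_; if_then_else_)
  open import Data.Product using (_×_; _,_)
  open import Data.Sum using (_⊎_; inj₁; inj₂)
  open import Data.Empty using (⊥-elim)
  open import Relation.Nullary using (¬_; Dec; yes; no)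
  open import Relation.Nullary.Decidable using (⌊_⌋; _×-dec_; _⊎-dec_)
  open import Relation.Binary.PropositionalEquality
  open import Algebra.Properties.Semiring.Sum +-*-semiring
    using (sum; sum-cong-≗; sum-replicate-zero; ∑-distrib-+; *-distribˡ-sum)

  𝟙 : ∀ {p} {P : Set p} → Dec P → ℕ
  𝟙 (yes _) = 1
  𝟙 (no _)  = 0

  𝟙-yes : ∀ {p} {P : Set p} → P → (d : Dec P) → 𝟙 d ≡ 1
  𝟙-yes _ (yes _) = refl
  𝟙-yes p (no ¬p) = ⊥-elim (¬p p)

  𝟙-no : ∀ {p} {P : Set p} → ¬ P → (d : Dec P) → 𝟙 d ≡ 0
  𝟙-no ¬p (yes p) = ⊥-elim (¬p p)
  𝟙-no _  (no _)  = refl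

  𝟙-× : ∀ {p q} {P : Set p} {Q : Set q} (d : Dec P) (e : Dec Q) → 𝟙 (d ×-dec e) ≡ 𝟙 d * 𝟙 e
  𝟙-× (yes _) (yes _) = refl
  𝟙-× (yes _) (no _)  = refl
  𝟙-× (no _)  _       = refl

  𝟙-⊎ : ∀ {p q} {P : Set p} {Q : Set q} (d : Dec P) (e : Dec Q) → ¬ (P × Q) → 𝟙 (d ⊎-dec e) ≡ 𝟙 d + 𝟙 e
  𝟙-⊎ (yes p) (yes q) disjoint = ⊥-elim (disjoint (p , q))
  𝟙-⊎ (yes _) (no _)  _ = refl
  𝟙-⊎ (no _)  (yes _) _ = refl
  𝟙-⊎ (no _)  (no _)  _ = refl

  𝟙-⇔ : ∀ {p q} {P : Set p} {Q : Set q} → (P → Q) → (Q → P) → (d : Dec P) (e : Dec Q) → 𝟙 d ≡ 𝟙 e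
  𝟙-⇔ to from (yes p) e = sym (𝟙-yes (to p) e)
  𝟙-⇔ to from (no ¬p) e = sym (𝟙-no (λ q → ¬p (from q)) e)

  𝟙-×₃ : ∀ {p q r} {P : Set p} {Q : Set q} {R : Set r} (d : Dec P) (e : Dec Q) (f : Dec R) →
         𝟙 (d ×-dec (e ×-dec f)) ≡ 𝟙 d * (𝟙 e * 𝟙 f)
  𝟙-×₃ d e f = trans (𝟙-× d _) (cong (𝟙 d *_) (𝟙-× e f))

  𝟙-×₄ : ∀ {p q r s} {P : Set p} {Q : Set q} {R : Set r} {S : Set s} (d : Dec P) (e : Dec Q) (f : Dec R) (g : Dec S) →
         𝟙 (d ×-dec (e ×-dec (f ×-dec g))) ≡ 𝟙 d * (𝟙 e * (𝟙 f * 𝟙 g))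
  𝟙-×₄ d e f g = trans (𝟙-× d _) (cong (𝟙 d *_) (𝟙-×₃ e f g))

  𝟙-×₅ : ∀ {p q r s t} {P : Set p} {Q : Set q} {R : Set r} {S : Set s} {T : Set t}
         (d : Dec P) (e : Dec Q) (f : Dec R) (g : Dec S) (h : Dec T) →
         𝟙 (d ×-dec (e ×-dec (f ×-dec (g ×-dec h)))) ≡ 𝟙 d * (𝟙 e * (𝟙 f * (𝟙 g * 𝟙 h)))
  𝟙-×₅ d e f g h = trans (𝟙-× d _) (cong (𝟙 d *_) (𝟙-×₄ e f g h))

  ⟦_⟧ᵇ : Bool → ℕ
  ⟦ true  ⟧ᵇ = 1
  ⟦ false ⟧ᵇ = 0

  ⟦∧⟧ᵇ : ∀ a b → ⟦ a ∧ b ⟧ᵇ ≡ ⟦ a ⟧ᵇ * ⟦ b ⟧ᵇ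
  ⟦∧⟧ᵇ true  b = sym (+-identityʳ _)
  ⟦∧⟧ᵇ false b = refl

  count≡sum : ∀ {n} (f : Fin n → Bool) → count f ≡ sum (λ w → ⟦ f w ⟧ᵇ)
  count≡sum {zero}  f = refl
  count≡sum {suc n} f = cong₂ _+_ (if-⟦⟧ (f zero)) (count≡sum (λ i → f (suc i)))
    where
    if-⟦⟧ : ∀ b → (if b then 1 else 0) ≡ ⟦ b ⟧ᵇ
    if-⟦⟧ true  = refl
    if-⟦⟧ false = refl

  sum-zero : ∀ {n} → sum {n} (λ _ → 0) ≡ 0
  sum-zero {n} = sum-replicate-zero n

  count-cong : ∀ {n} (f g : Fin n → Bool) → (∀ w → ⟦ f w ⟧ᵇ ≡ ⟦ g w ⟧ᵇ) → count f ≡ count g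
  count-cong f g e = trans (count≡sum f) (trans (sum-cong-≗ e) (sym (count≡sum g)))

  count-split : ∀ {n} (f g h : Fin n → Bool) → (∀ w → ⟦ f w ⟧ᵇ ≡ ⟦ g w ⟧ᵇ + ⟦ h w ⟧ᵇ) → count f ≡ count g + count h
  count-split f g h e = trans (count≡sum f) (trans (sum-cong-≗ e)
    (trans (∑-distrib-+ (λ w → ⟦ g w ⟧ᵇ) (λ w → ⟦ h w ⟧ᵇ)) (sym (cong₂ _+_ (count≡sum g) (count≡sum h)))))

  count-zero : ∀ {n} (f : Fin n → Bool) → (∀ w → ⟦ f w ⟧ᵇ ≡ 0) → count f ≡ 0
  count-zero {n} f e = trans (count≡sum f) (trans (sum-cong-≗ e) (sum-zero {n}))

  sum-scaled-count : ∀ {n} (f : Fin n → ℕ) k (p : Fin n → Bool) → (∀ w → f w ≡ k * ⟦ p w ⟧ᵇ) → sum f ≡ k * count p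
  sum-scaled-count f k p e =
    trans (sum-cong-≗ e) (trans (sym (*-distribˡ-sum k (λ w → ⟦ p w ⟧ᵇ))) (cong (k *_) (sym (count≡sum p))))

  sum-linear-count : ∀ {n} k l (p q : Fin n → Bool) →
                     sum (λ w → k * ⟦ p w ⟧ᵇ + l * ⟦ q w ⟧ᵇ) ≡ k * count p + l * count q
  sum-linear-count k l p q = trans (∑-distrib-+ (λ w → k * ⟦ p w ⟧ᵇ) (λ w → l * ⟦ q w ⟧ᵇ))
    (cong₂ _+_ (sum-scaled-count _ k p (λ _ → refl)) (sum-scaled-count _ l q (λ _ → refl)))

  sum-δ : ∀ {n} (u : Fin n) (f : Fin n → ℕ) → sum (λ w → if ⌊ u ≟ᶠ w ⌋ then f w else 0) ≡ f u
  sum-δ {suc n} zero    f = trans (cong (f zero +_) (sum-zero {n})) (+-identityʳ _)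
  sum-δ {suc n} (suc u) f = cong (_ +_) (trans (sum-cong-≗ shift) (sum-δ u (λ i → f (suc i))))
    where
    shift : ∀ i → (if ⌊ suc u ≟ᶠ suc i ⌋ then f (suc i) else 0) ≡ (if ⌊ u ≟ᶠ i ⌋ then f (suc i) else 0)
    shift i with u ≟ᶠ i
    ... | yes refl = refl
    ... | no _     = refl

  rangeSum : ℕ → ℕ → (ℕ → ℕ) → ℕ
  rangeSum lo zero      f = 0
  rangeSum lo (suc len) f = f lo + rangeSum (suc lo) len f

  rangeSum-cong : ∀ lo len {f g : ℕ → ℕ} → (∀ h → f h ≡ g h) → rangeSum lo len f ≡ rangeSum lo len g
  rangeSum-cong lo zero      e = refl
  rangeSum-cong lo (suc len) e = cong₂ _+_ (e lo) (rangeSum-cong (suc lo) len e)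

  rangeSum-δ-outside : ∀ lo len t (f : ℕ → ℕ) → t < lo ⊎ lo + len ≤ t → rangeSum lo len (λ h → 𝟙 (h ≟ t) * f h) ≡ 0
  rangeSum-δ-outside lo zero      t f _ = refl
  rangeSum-δ-outside lo (suc len) t f outside =
    cong₂ _+_ (cong (_* f lo) (𝟙-no (lo≢t outside) (lo ≟ t))) (rangeSum-δ-outside (suc lo) len t f (shift outside))
    where
    lo≢t : t < lo ⊎ lo + suc len ≤ t → ¬ lo ≡ t
    lo≢t (inj₁ t<lo) refl = <-irrefl refl t<lo
    lo≢t (inj₂ le)   refl = <-irrefl refl (≤-trans (s≤s (m≤m+n lo len)) (≤-trans (≤-reflexive (sym (+-suc lo len))) le))
    shift : t < lo ⊎ lo + suc len ≤ t → t < suc lo ⊎ suc lo + len ≤ t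
    shift (inj₁ t<lo) = inj₁ (m<n⇒m<1+n t<lo)
    shift (inj₂ le)   = inj₂ (≤-trans (≤-reflexive (sym (+-suc lo len))) le)

  rangeSum-δ-inside : ∀ lo len t (f : ℕ → ℕ) → lo ≤ t → t < lo + len → rangeSum lo len (λ h → 𝟙 (h ≟ t) * f h) ≡ f t
  rangeSum-δ-inside lo zero t f lo≤t t<lo = ⊥-elim (<-irrefl refl (≤-trans t<lo (≤-trans (≤-reflexive (+-identityʳ lo)) lo≤t)))
  rangeSum-δ-inside lo (suc len) t f lo≤t t<end with lo ≟ t
  ... | yes refl = trans (cong (f lo + 0 +_) (rangeSum-δ-outside (suc lo) len lo f (inj₁ ≤-refl)))
                         (trans (+-identityʳ _) (+-identityʳ _))
  ... | no lo≢t  = rangeSum-δ-inside (suc lo) len t f (≤∧≢⇒< lo≤t lo≢t) (subst (t <_) (+-suc lo len) t<end)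

module NatMatrices where

  open import Data.Nat using (ℕ; zero; suc; _+_; _*_; _∸_; _<_; z≤n; s≤s)
  open import Data.Nat.Properties
  open import Data.Fin using (Fin)
  open import Data.Fin.Properties using () renaming (_≟_ to _≟ᶠ_)
  open import Data.Bool using (if_then_else_)
  open import Relation.Nullary using (yes; no)
  open import Relation.Nullary.Decidable using (⌊_⌋)
  open import Relation.Binary.PropositionalEquality
  open import Algebra.Properties.Semiring.Sum +-*-semiring
    using (sum; sum-cong-≗; ∑-distrib-+; ∑-comm; *-distribˡ-sum; *-distribʳ-sum)
  open ≡-Reasoning
  open Counting using (sum-zero; sum-δ; rangeSum)

  Matℕ : ℕ → Set
  Matℕ n = Fin n → Fin n → ℕ

  infix 4 _≐_
  infixl 6 _⊕ℕ_
  infixl 7 _⊗ℕ_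

  _≐_ : ∀ {n} → Matℕ n → Matℕ n → Set
  M ≐ N = ∀ u v → M u v ≡ N u v

  _⊗ℕ_ : ∀ {n} → Matℕ n → Matℕ n → Matℕ n
  (M ⊗ℕ N) u v = sum (λ w → M u w * N w v)

  _⊕ℕ_ : ∀ {n} → Matℕ n → Matℕ n → Matℕ n
  (M ⊕ℕ N) u v = M u v + N u v

  𝟏ℕ : ∀ {n} → Matℕ n
  𝟏ℕ u v = if ⌊ u ≟ᶠ v ⌋ then 1 else 0

  𝟎ℕ : ∀ {n} → Matℕ n
  𝟎ℕ u v = 0

  _^ℕ_ : ∀ {n} → Matℕ n → ℕ → Matℕ n
  M ^ℕ zero  = 𝟏ℕ
  M ^ℕ suc m = M ⊗ℕ (M ^ℕ m)

  sumRangeℕ : ∀ {n} → ℕ → ℕ → (ℕ → Matℕ n) → Matℕ n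
  sumRangeℕ lo zero      f = 𝟎ℕ
  sumRangeℕ lo (suc len) f = f lo ⊕ℕ sumRangeℕ (suc lo) len f

  module _ {n : ℕ} where

    ≐-refl : {M : Matℕ n} → M ≐ M
    ≐-refl u v = refl

    ≐-sym : {M N : Matℕ n} → M ≐ N → N ≐ M
    ≐-sym e u v = sym (e u v)

    ≐-trans : {M N P : Matℕ n} → M ≐ N → N ≐ P → M ≐ P
    ≐-trans e f u v = trans (e u v) (f u v)

    ⊕ℕ-cong : {M M' N N' : Matℕ n} → M ≐ M' → N ≐ N' → M ⊕ℕ N ≐ M' ⊕ℕ N'
    ⊕ℕ-cong e f u v = cong₂ _+_ (e u v) (f u v)

    ⊗ℕ-congˡ : (M : Matℕ n) {N N' : Matℕ n} → N ≐ N' → M ⊗ℕ N ≐ M ⊗ℕ N'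
    ⊗ℕ-congˡ M e u v = sum-cong-≗ (λ w → cong (M u w *_) (e w v))

    ⊗ℕ-assoc : (M N P : Matℕ n) → (M ⊗ℕ N) ⊗ℕ P ≐ M ⊗ℕ (N ⊗ℕ P)
    ⊗ℕ-assoc M N P u v = begin
      sum (λ w → sum (λ z → M u z * N z w) * P w v)  ≡⟨ sum-cong-≗ (λ w → *-distribʳ-sum (P w v) (λ z → M u z * N z w)) ⟩
      sum (λ w → sum (λ z → M u z * N z w * P w v))  ≡⟨ ∑-comm (λ w z → M u z * N z w * P w v) ⟩
      sum (λ z → sum (λ w → M u z * N z w * P w v))  ≡⟨ sum-cong-≗ (λ z → sum-cong-≗ (λ w → *-assoc (M u z) (N z w) (P w v))) ⟩
      sum (λ z → sum (λ w → M u z * (N z w * P w v))) ≡⟨ sum-cong-≗ (λ z → sym (*-distribˡ-sum (M u z) (λ w → N z w * P w v))) ⟩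
      sum (λ z → M u z * sum (λ w → N z w * P w v))  ∎

    ⊗ℕ-distribˡ-⊕ℕ : (M N P : Matℕ n) → M ⊗ℕ (N ⊕ℕ P) ≐ M ⊗ℕ N ⊕ℕ M ⊗ℕ P
    ⊗ℕ-distribˡ-⊕ℕ M N P u v =
      trans (sum-cong-≗ (λ w → *-distribˡ-+ (M u w) (N w v) (P w v))) (∑-distrib-+ (λ w → M u w * N w v) (λ w → M u w * P w v))

    ⊗ℕ-zeroʳ : (M : Matℕ n) → M ⊗ℕ 𝟎ℕ ≐ 𝟎ℕ
    ⊗ℕ-zeroʳ M u v = trans (sum-cong-≗ (λ w → *-zeroʳ (M u w))) (sum-zero {n})

    ⊗ℕ-identityˡ : (M : Matℕ n) → 𝟏ℕ ⊗ℕ M ≐ M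
    ⊗ℕ-identityˡ M u v = trans (sum-cong-≗ δ) (sum-δ u (λ w → M w v))
      where
      δ : ∀ w → 𝟏ℕ u w * M w v ≡ (if ⌊ u ≟ᶠ w ⌋ then M w v else 0)
      δ w with u ≟ᶠ w
      ... | yes _ = *-identityˡ (M w v)
      ... | no _  = refl

    ⊗ℕ-distribˡ-sumRange : (M : Matℕ n) → ∀ lo len (f : ℕ → Matℕ n) →
                           M ⊗ℕ sumRangeℕ lo len f ≐ sumRangeℕ lo len (λ j → M ⊗ℕ f j)
    ⊗ℕ-distribˡ-sumRange M lo zero      f = ⊗ℕ-zeroʳ M
    ⊗ℕ-distribˡ-sumRange M lo (suc len) f =
      ≐-trans (⊗ℕ-distribˡ-⊕ℕ M (f lo) _) (⊕ℕ-cong ≐-refl (⊗ℕ-distribˡ-sumRange M (suc lo) len f))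

    sumRangeℕ-snoc : ∀ lo len (f : ℕ → Matℕ n) → sumRangeℕ lo (suc len) f ≐ sumRangeℕ lo len f ⊕ℕ f (lo + len)
    sumRangeℕ-snoc lo zero      f u v = trans (+-identityʳ _) (cong (λ h → f h u v) (sym (+-identityʳ lo)))
    sumRangeℕ-snoc lo (suc len) f u v = begin
      f lo u v + sumRangeℕ (suc lo) (suc len) f u v               ≡⟨ cong (f lo u v +_) (sumRangeℕ-snoc (suc lo) len f u v) ⟩
      f lo u v + (sumRangeℕ (suc lo) len f u v + f (suc lo + len) u v) ≡⟨ sym (+-assoc (f lo u v) _ _) ⟩
      f lo u v + sumRangeℕ (suc lo) len f u v + f (suc lo + len) u v  ≡⟨ cong (λ h → f lo u v + sumRangeℕ (suc lo) len f u v + f h u v) (sym (+-suc lo len)) ⟩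
      f lo u v + sumRangeℕ (suc lo) len f u v + f (lo + suc len) u v  ∎

    sumRangeℕ-cong : ∀ lo len {f g : ℕ → Matℕ n} → (∀ j → j < lo + len → f j ≐ g j) → sumRangeℕ lo len f ≐ sumRangeℕ lo len g
    sumRangeℕ-cong lo zero      e = ≐-refl
    sumRangeℕ-cong lo (suc len) e = ⊕ℕ-cong (e lo (m<m+n lo (s≤s z≤n)))
      (sumRangeℕ-cong (suc lo) len (λ j j<end → e j (subst (j <_) (sym (+-suc lo len)) j<end)))

    sumRangeℕ-entry : ∀ lo len (f : ℕ → Matℕ n) u v → sumRangeℕ lo len f u v ≡ rangeSum lo len (λ h → f h u v)
    sumRangeℕ-entry lo zero      f u v = refl
    sumRangeℕ-entry lo (suc len) f u v = cong (f lo u v +_) (sumRangeℕ-entry (suc lo) len f u v)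

  horner : ∀ {n} → Matℕ n → (ℕ → Matℕ n) → ℕ → Matℕ n
  horner M Z zero    = 𝟎ℕ
  horner M Z (suc m) = M ⊗ℕ horner M Z m ⊕ℕ Z m

  sumRangeℕ-pow≐horner : ∀ {n} (M : Matℕ n) (Z : ℕ → Matℕ n) m →
                         sumRangeℕ 0 m (λ j → M ^ℕ (m ∸ j) ⊗ℕ Z j) ≐ M ⊗ℕ horner M Z m
  sumRangeℕ-pow≐horner M Z zero    = ≐-sym (⊗ℕ-zeroʳ M)
  sumRangeℕ-pow≐horner M Z (suc m) =
    ≐-trans (sumRangeℕ-snoc 0 m _) (≐-trans (⊕ℕ-cong earlier last) (≐-sym (⊗ℕ-distribˡ-⊕ℕ M (M ⊗ℕ horner M Z m) (Z m))))
    where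
    earlier : sumRangeℕ 0 m (λ j → M ^ℕ (suc m ∸ j) ⊗ℕ Z j) ≐ M ⊗ℕ (M ⊗ℕ horner M Z m)
    earlier = ≐-trans (sumRangeℕ-cong 0 m (λ j j<m u v → trans (cong (λ e → (M ^ℕ e ⊗ℕ Z j) u v) (+-∸-assoc 1 (<⇒≤ j<m)))
                                                              (⊗ℕ-assoc M (M ^ℕ (m ∸ j)) (Z j) u v)))
              (≐-trans (≐-sym (⊗ℕ-distribˡ-sumRange M 0 m (λ j → M ^ℕ (m ∸ j) ⊗ℕ Z j)))
                       (⊗ℕ-congˡ M (sumRangeℕ-pow≐horner M Z m)))
    last : M ^ℕ (suc m ∸ (0 + m)) ⊗ℕ Z (0 + m) ≐ M ⊗ℕ Z m
    last u v = trans (cong (λ e → (M ^ℕ e ⊗ℕ Z m) u v) (m+n∸n≡m 1 m))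
                     (trans (⊗ℕ-assoc M 𝟏ℕ (Z m) u v) (⊗ℕ-congˡ M (⊗ℕ-identityˡ (Z m)) u v))

-- The ring solver needs coefficients with (weakly) decidable equality, hence the detour through ℤ.
module IntegerEmbedding {c ℓ} (R : CommutativeRing c ℓ) where

  open import Data.Nat using (ℕ; zero; suc) renaming (_+_ to _+ℕ_; _*_ to _*ℕ_)
  import Data.Nat.Properties as ℕ
  open import Data.Integer using (ℤ; +_; -[1+_]; _⊖_; sign; ∣_∣; _◃_)
  import Data.Integer as ℤ
  open import Data.Integer.Properties using ([1+m]⊖[1+n]≡m⊖n)
  open import Data.Sign using (Sign) renaming (+ to s+; - to s-; _*_ to _*ˢ_)
  open import Data.Maybe using (Maybe; nothing; just)
  open import Relation.Nullary using (yes; no)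
  import Relation.Binary.PropositionalEquality as ≡
  open import Algebra.Solver.Ring.AlmostCommutativeRing using (fromCommutativeRing; _-Raw-AlmostCommutative⟶_)
  import Algebra.Properties.Ring as RingProperties
  import Algebra.Properties.CommutativeSemigroup as CommutativeSemigroupProperties
  import Algebra.Solver.Ring as RingSolver

  open CommutativeRing R hiding (zero)
  open RingProperties ring using (-1*x≈-x; -‿involutive; -0#≈0#; -‿+-comm)
  open CommutativeSemigroupProperties *-commutativeSemigroup using (interchange)

  ι : ℕ → Carrier
  ι = ιR R

  ι-+ : ∀ a b → ι (a +ℕ b) ≈ ι a + ι b
  ι-+ zero    b = sym (+-identityˡ _)
  ι-+ (suc a) b = trans (+-congˡ (ι-+ a b)) (sym (+-assoc _ _ _))

  ι-* : ∀ a b → ι (a *ℕ b) ≈ ι a * ι b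
  ι-* zero    b = sym (zeroˡ _)
  ι-* (suc a) b = trans (ι-+ b (a *ℕ b)) (trans (+-cong (sym (*-identityˡ _)) (ι-* a b)) (sym (distribʳ _ _ _)))

  ι-1 : ι 1 ≈ 1#
  ι-1 = +-identityʳ _

  ⟦_⟧ℤ : ℤ → Carrier
  ⟦ + n      ⟧ℤ = ι n
  ⟦ -[1+ n ] ⟧ℤ = - ι (suc n)

  private
    ⊖-homo : ∀ m n → ⟦ m ⊖ n ⟧ℤ ≈ ι m + - ι n
    ⊖-homo m       zero    = sym (trans (+-congˡ -0#≈0#) (+-identityʳ _))
    ⊖-homo zero    (suc n) = sym (+-identityˡ _)
    ⊖-homo (suc m) (suc n) rewrite [1+m]⊖[1+n]≡m⊖n m n = trans (⊖-homo m n) (sym cancel-1)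
      where
      cancel-1 : (1# + ι m) + - (1# + ι n) ≈ ι m + - ι n
      cancel-1 = trans (+-congˡ (sym (-‿+-comm 1# (ι n))))
        (trans (+-congʳ (+-comm 1# (ι m)))
        (trans (+-assoc (ι m) 1# _)
        (trans (+-congˡ (sym (+-assoc 1# (- 1#) (- ι n))))
        (trans (+-congˡ (+-congʳ (-‿inverseʳ 1#))) (+-congˡ (+-identityˡ _))))))

    sign-value : Sign → Carrier
    sign-value s+ = 1#
    sign-value s- = - 1#

    ◃-homo : ∀ s n → ⟦ s ◃ n ⟧ℤ ≈ sign-value s * ι n
    ◃-homo s  zero    = sym (zeroʳ _)
    ◃-homo s+ (suc n) = sym (*-identityˡ _)
    ◃-homo s- (suc n) = sym (-1*x≈-x _)

    sign-*-homo : ∀ s t → sign-value (s *ˢ t) ≈ sign-value s * sign-value t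
    sign-*-homo s+ s+ = sym (*-identityˡ _)
    sign-*-homo s+ s- = sym (*-identityˡ _)
    sign-*-homo s- s+ = sym (*-identityʳ _)
    sign-*-homo s- s- = sym (trans (-1*x≈-x _) (-‿involutive _))

    sign-abs : ∀ i → ⟦ i ⟧ℤ ≈ sign-value (sign i) * ι ∣ i ∣
    sign-abs (+ n)      = sym (*-identityˡ _)
    sign-abs -[1+ n ]   = sym (-1*x≈-x _)

  ⟦⟧ℤ-+ : ∀ i j → ⟦ i ℤ.+ j ⟧ℤ ≈ ⟦ i ⟧ℤ + ⟦ j ⟧ℤ
  ⟦⟧ℤ-+ (+ m)      (+ n)      = ι-+ m n
  ⟦⟧ℤ-+ (+ m)      -[1+ n ]   = ⊖-homo m (suc n)
  ⟦⟧ℤ-+ -[1+ m ]   (+ n)      = trans (⊖-homo n (suc m)) (+-comm _ _)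
  ⟦⟧ℤ-+ -[1+ m ]   -[1+ n ]   =
    trans (-‿cong (trans (reflexive (≡.cong ι (≡.sym (ℕ.+-suc (suc m) n)))) (ι-+ (suc m) (suc n))))
          (sym (-‿+-comm _ _))

  ⟦⟧ℤ-* : ∀ i j → ⟦ i ℤ.* j ⟧ℤ ≈ ⟦ i ⟧ℤ * ⟦ j ⟧ℤ
  ⟦⟧ℤ-* i j = trans (◃-homo (sign i *ˢ sign j) (∣ i ∣ *ℕ ∣ j ∣))
    (trans (*-cong (sign-*-homo (sign i) (sign j)) (ι-* ∣ i ∣ ∣ j ∣))
    (trans (interchange _ _ _ _) (sym (*-cong (sign-abs i) (sign-abs j)))))

  ⟦⟧ℤ-neg : ∀ i → ⟦ ℤ.- i ⟧ℤ ≈ - ⟦ i ⟧ℤ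
  ⟦⟧ℤ-neg (+ zero)  = sym -0#≈0#
  ⟦⟧ℤ-neg (+ suc n) = refl
  ⟦⟧ℤ-neg -[1+ n ]  = sym (-‿involutive _)

  ⟦⟧ℤ-morphism : ℤ.+-*-rawRing -Raw-AlmostCommutative⟶ fromCommutativeRing R
  ⟦⟧ℤ-morphism = record
    { ⟦_⟧ = ⟦_⟧ℤ ; +-homo = ⟦⟧ℤ-+ ; *-homo = ⟦⟧ℤ-* ; -‿homo = ⟦⟧ℤ-neg ; 0-homo = refl ; 1-homo = ι-1 }

  private
    ≟-coefficients : ∀ i j → Maybe (⟦ i ⟧ℤ ≈ ⟦ j ⟧ℤ)
    ≟-coefficients i j with i ℤ.≟ j
    ... | yes ≡.refl = just refl
    ... | no _       = nothing

  open RingSolver ℤ.+-*-rawRing (fromCommutativeRing R) ⟦⟧ℤ-morphism ≟-coefficients public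
    using (solve; _:=_; _:+_; _:*_; :-_; con)

module MatrixTransport {c ℓ} (F : CharZeroField c ℓ) where

  open import Data.Nat using (ℕ; zero; suc) renaming (_*_ to _*ℕ_)
  open import Data.Nat.Properties using (+-*-semiring)
  open import Algebra.Properties.Semiring.Sum +-*-semiring using (sum)
  open import Data.Fin using (Fin; zero; suc)
  open import Data.Fin.Properties using (_≟_)
  open import Data.Bool using (true; false)
  open import Relation.Nullary.Decidable using (⌊_⌋)
  import Relation.Binary.PropositionalEquality as ≡
  open Counting
  open NatMatrices

  open CharZeroField F hiding (zero)
  open Matrices F
  open IntegerEmbedding cring using (ι-+; ι-*; ι-1)

  ιM : ∀ {n} → Matℕ n → Mat n
  ιM M u v = ι (M u v)

  boolF≈ι : ∀ b → boolF b ≈ ι ⟦ b ⟧ᵇ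
  boolF≈ι true  = sym ι-1
  boolF≈ι false = refl

  module _ {n : ℕ} where

    sumF-ι : ∀ {m} (f : Fin m → ℕ) → sumF (λ i → ι (f i)) ≈ ι (sum f)
    sumF-ι {zero}  f = refl
    sumF-ι {suc m} f = trans (+-congˡ (sumF-ι (λ i → f (suc i)))) (sym (ι-+ (f zero) _))

    sumF-cong : ∀ {m} {f g : Fin m → Carrier} → (∀ i → f i ≈ g i) → sumF f ≈ sumF g
    sumF-cong {zero}  e = refl
    sumF-cong {suc m} e = +-cong (e zero) (sumF-cong (λ i → e (suc i)))

    ⊗-ιM : {M N : Mat n} {M' N' : Matℕ n} → M ≋ ιM M' → N ≋ ιM N' → (M ⊗ N) ≋ ιM (M' ⊗ℕ N')
    ⊗-ιM {M' = M'} {N'} e f u v =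
      trans (sumF-cong (λ w → trans (*-cong (e u w) (f w v)) (sym (ι-* (M' u w) (N' w v)))))
            (sumF-ι (λ w → M' u w *ℕ N' w v))

    ⊕-ιM : {M N : Mat n} {M' N' : Matℕ n} → M ≋ ιM M' → N ≋ ιM N' → (M ⊕ N) ≋ ιM (M' ⊕ℕ N')
    ⊕-ιM {M' = M'} {N'} e f u v = trans (+-cong (e u v) (f u v)) (sym (ι-+ (M' u v) (N' u v)))

    𝟏-ιM : 𝟏 {n} ≋ ιM 𝟏ℕ
    𝟏-ιM u v with ⌊ u ≟ v ⌋
    ... | true  = sym ι-1
    ... | false = refl

    ^^-ιM : {M : Mat n} {M' : Matℕ n} → M ≋ ιM M' → ∀ k → (M ^^ k) ≋ ιM (M' ^ℕ k)
    ^^-ιM e zero    = 𝟏-ιM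
    ^^-ιM {M' = M'} e (suc k) = ⊗-ιM {M' = M'} {M' ^ℕ k} e (^^-ιM e k)

    sumRange-ιM : ∀ lo len {f : ℕ → Mat n} {f' : ℕ → Matℕ n} →
                  (∀ j → f j ≋ ιM (f' j)) → sumRange lo len f ≋ ιM (sumRangeℕ lo len f')
    sumRange-ιM lo zero      e u v = refl
    sumRange-ιM lo (suc len) {f' = f'} e = ⊕-ιM {M' = f' lo} {sumRangeℕ (suc lo) len f'} (e lo) (sumRange-ιM (suc lo) len e)

    ιM-≐ : {M : Mat n} {M' M'' : Matℕ n} → M ≋ ιM M' → M' ≐ M'' → M ≋ ιM M''
    ιM-≐ e f u v = trans (e u v) (reflexive (≡.cong ι (f u v)))

module Entries {n : ℕ} (G : Graph n) (D : ℕ) (b c : ℕ → ℕ) (x : Fin n)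
               (drg : IsDRG G b c) (diam : HasDiameter G D) (bip : Bipartite G) where

  open import Data.Nat using (ℕ; zero; suc; _+_; _*_; _∸_; _≤_; z≤n; s≤s; _≟_; _<?_)
  open import Data.Nat.Properties
  open import Algebra.Properties.Semiring.Sum +-*-semiring using (sum; sum-cong-≗; ∑-distrib-+)
  open import Data.Fin using (Fin)
  open import Data.Fin.Properties using () renaming (_≟_ to _≟ᶠ_)
  open import Data.Bool using (Bool; true; false; _∧_; if_then_else_)
  open import Data.Product using (_×_; _,_; proj₁)
  open import Data.Sum using (_⊎_; inj₁; inj₂)
  open import Data.Empty using (⊥; ⊥-elim)
  open import Relation.Nullary using (¬_; Dec; yes; no)
  open import Relation.Nullary.Decidable using (⌊_⌋; _×-dec_; _⊎-dec_)
  open import Relation.Binary.Definitions using (tri<; tri≈; tri>)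
  open import Relation.Binary.PropositionalEquality
  open import Data.Nat.Solver using (module +-*-Solver)
  open +-*-Solver using (solve; _:=_; _:+_; _:*_; con)
  open ≡-Reasoning
  open Counting
  open NatMatrices

  open Graph G
  open IsDRG drg
  open Metric G connected

  lev : Fin n → ℕ
  lev w = dist x w

  lev≤D : ∀ w → lev w ≤ D
  lev≤D w = proj₁ diam x w (lev w) (Dist-dist x w)

  private
    true≢false : ¬ true ≡ false
    true≢false ()

  ⟦isDist⟧ : ∀ u w j → ⟦ isDist G u w j ⟧ᵇ ≡ 𝟙 (j ≟ dist u w)
  ⟦isDist⟧ u w j with isDist G u w j in eq | j ≟ dist u w
  ... | true  | yes _    = refl
  ... | true  | no j≢d   = ⊥-elim (j≢d (sym (Dist⇒dist≡ {u} {w} {j} eq)))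
  ... | false | yes j≡d  = ⊥-elim (true≢false (trans (sym (dist≡⇒Dist {u} {w} {j} (sym j≡d))) eq))
  ... | false | no _     = refl

  ⟦adj⟧ : ∀ u w → ⟦ adj u w ⟧ᵇ ≡ 𝟙 (1 ≟ dist u w)
  ⟦adj⟧ u w with adj u w in eq | 1 ≟ dist u w
  ... | true  | yes _   = refl
  ... | true  | no 1≢d  = ⊥-elim (1≢d (sym (adj⇒dist≡1 eq)))
  ... | false | yes 1≡d = ⊥-elim (true≢false (trans (sym (dist≡1⇒adj {u} {w} (sym 1≡d))) eq))
  ... | false | no _    = refl

  ⟦isDist∧isDist⟧ : ∀ u v z j → ⟦ isDist G v z j ∧ isDist G u z 1 ⟧ᵇ ≡ 𝟙 (j ≟ dist v z) * 𝟙 (1 ≟ dist u z)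
  ⟦isDist∧isDist⟧ u v z j = trans (⟦∧⟧ᵇ (isDist G v z j) _) (cong₂ _*_ (⟦isDist⟧ v z j) (⟦isDist⟧ u z 1))

  adjacent : ∀ {u z} → 1 ≡ dist u z → adj u z ≡ true
  adjacent e = dist≡1⇒adj (sym e)

  adjacent⁻ : ∀ {u z} → 1 ≡ dist u z → adj z u ≡ true
  adjacent⁻ {u} {z} e = trans (symm z u) (adjacent e)

  level-step : ∀ {u z} → 1 ≡ dist u z → lev z ≡ suc (lev u) ⊎ lev u ≡ suc (lev z)
  level-step e = adj⇒dist-step bip (adjacent e)

  Aℕ : Matℕ n
  Aℕ u w = ⟦ adj u w ⟧ᵇ

  E*ℕ : ℕ → Matℕ n
  E*ℕ j u v = if ⌊ u ≟ᶠ v ⌋ then ⟦ isDist G x u j ⟧ᵇ else 0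

  E*ℕ-left : ∀ a (M : Matℕ n) u v → (E*ℕ a ⊗ℕ M) u v ≡ 𝟙 (a ≟ lev u) * M u v
  E*ℕ-left a M u v =
    trans (sum-cong-≗ δ) (trans (sum-δ u (λ w → ⟦ isDist G x u a ⟧ᵇ * M w v)) (cong (_* M u v) (⟦isDist⟧ x u a)))
    where
    δ : ∀ w → E*ℕ a u w * M w v ≡ (if ⌊ u ≟ᶠ w ⌋ then ⟦ isDist G x u a ⟧ᵇ * M w v else 0)
    δ w with u ≟ᶠ w
    ... | yes _ = refl
    ... | no _  = refl

  E*ℕ-right : ∀ a (M : Matℕ n) u v → (M ⊗ℕ E*ℕ a) u v ≡ M u v * 𝟙 (a ≟ lev v)
  E*ℕ-right a M u v =
    trans (sum-cong-≗ δ) (trans (sum-δ v (λ w → M u w * ⟦ isDist G x w a ⟧ᵇ)) (cong (M u v *_) (⟦isDist⟧ x v a)))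
    where
    δ : ∀ w → M u w * E*ℕ a w v ≡ (if ⌊ v ≟ᶠ w ⌋ then M u w * ⟦ isDist G x w a ⟧ᵇ else 0)
    δ w with w ≟ᶠ v | v ≟ᶠ w
    ... | yes refl | yes _   = refl
    ... | yes refl | no v≢v  = ⊥-elim (v≢v refl)
    ... | no w≢v   | yes v≡w = ⊥-elim (w≢v (sym v≡w))
    ... | no _     | no _    = *-zeroʳ (M u w)

  E*AE*-entry : ∀ a h u w → (E*ℕ a ⊗ℕ (Aℕ ⊗ℕ E*ℕ h)) u w ≡ 𝟙 (h ≟ lev w) * (𝟙 (a ≟ lev u) * 𝟙 (1 ≟ dist u w))
  E*AE*-entry a h u w = begin
    (E*ℕ a ⊗ℕ (Aℕ ⊗ℕ E*ℕ h)) u w                            ≡⟨ E*ℕ-left a (Aℕ ⊗ℕ E*ℕ h) u w ⟩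
    𝟙 (a ≟ lev u) * (Aℕ ⊗ℕ E*ℕ h) u w                      ≡⟨ cong (𝟙 (a ≟ lev u) *_) (E*ℕ-right h Aℕ u w) ⟩
    𝟙 (a ≟ lev u) * (Aℕ u w * 𝟙 (h ≟ lev w))               ≡⟨ cong (λ t → 𝟙 (a ≟ lev u) * (t * 𝟙 (h ≟ lev w))) (⟦adj⟧ u w) ⟩
    𝟙 (a ≟ lev u) * (𝟙 (1 ≟ dist u w) * 𝟙 (h ≟ lev w))     ≡⟨ solve 3 (λ p q r → p :* (q :* r) := r :* (p :* q)) refl
                                                                   (𝟙 (a ≟ lev u)) (𝟙 (1 ≟ dist u w)) (𝟙 (h ≟ lev w)) ⟩
    𝟙 (h ≟ lev w) * (𝟙 (a ≟ lev u) * 𝟙 (1 ≟ dist u w))     ∎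

  Lℕ : Matℕ n
  Lℕ = sumRangeℕ 1 D (λ h → E*ℕ (h ∸ 1) ⊗ℕ (Aℕ ⊗ℕ E*ℕ h))

  Rℕ : Matℕ n
  Rℕ = sumRangeℕ 0 D (λ h → E*ℕ (suc h) ⊗ℕ (Aℕ ⊗ℕ E*ℕ h))

  lowering : Matℕ n
  lowering u w = 𝟙 (1 ≟ dist u w) * 𝟙 (lev w ≟ suc (lev u))

  raising : Matℕ n
  raising u w = 𝟙 (1 ≟ dist u w) * 𝟙 (lev u ≟ suc (lev w))

  Lℕ≐lowering : Lℕ ≐ lowering
  Lℕ≐lowering u w =
    trans (sumRangeℕ-entry 1 D _ u w) (trans (rangeSum-cong 1 D (λ h → E*AE*-entry (h ∸ 1) h u w)) (by-level (lev w) refl))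
    where
    by-level : ∀ t → lev w ≡ t → rangeSum 1 D (λ h → 𝟙 (h ≟ lev w) * (𝟙 (h ∸ 1 ≟ lev u) * 𝟙 (1 ≟ dist u w))) ≡ lowering u w
    by-level zero e rewrite e =
      trans (rangeSum-δ-outside 1 D 0 _ (inj₁ (s≤s z≤n))) (sym (*-zeroʳ (𝟙 (1 ≟ dist u w))))
    by-level (suc t) e rewrite e =
      trans (rangeSum-δ-inside 1 D (suc t) (λ h → 𝟙 (h ∸ 1 ≟ lev u) * 𝟙 (1 ≟ dist u w)) (s≤s z≤n) (s≤s (subst (_≤ D) e (lev≤D w))))
      (trans (*-comm (𝟙 (t ≟ lev u)) (𝟙 (1 ≟ dist u w)))
             (cong (𝟙 (1 ≟ dist u w) *_) (𝟙-⇔ (cong suc) suc-injective (t ≟ lev u) (suc t ≟ suc (lev u)))))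

  Rℕ≐raising : Rℕ ≐ raising
  Rℕ≐raising u w =
    trans (sumRangeℕ-entry 0 D _ u w) (trans (rangeSum-cong 0 D (λ h → E*AE*-entry (suc h) h u w)) by-level)
    where
    by-level : rangeSum 0 D (λ h → 𝟙 (h ≟ lev w) * (𝟙 (suc h ≟ lev u) * 𝟙 (1 ≟ dist u w))) ≡ raising u w
    by-level with lev w <? D
    ... | yes lev<D =
      trans (rangeSum-δ-inside 0 D (lev w) (λ h → 𝟙 (suc h ≟ lev u) * 𝟙 (1 ≟ dist u w)) z≤n lev<D)
      (trans (*-comm (𝟙 (suc (lev w) ≟ lev u)) (𝟙 (1 ≟ dist u w)))
             (cong (𝟙 (1 ≟ dist u w) *_) (𝟙-⇔ sym sym (suc (lev w) ≟ lev u) (lev u ≟ suc (lev w)))))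
    ... | no lev≮D =
      trans (rangeSum-δ-outside 0 D (lev w) _ (inj₂ (≮⇒≥ lev≮D)))
      (sym (trans (cong (𝟙 (1 ≟ dist u w) *_) (𝟙-no (λ e → lev≮D (subst (_≤ D) e (lev≤D u))) (lev u ≟ suc (lev w))))
                  (*-zeroʳ (𝟙 (1 ≟ dist u w)))))

  -- the number of geodesics between two vertices at distance k
  cProd : ℕ → ℕ
  cProd zero    = 1
  cProd (suc k) = cProd k * c (suc k)

  raisingPower : ℕ → Matℕ n
  raisingPower k u w = 𝟙 (lev u ≟ k + lev w) * 𝟙 (k ≟ dist w u) * cProd k

  raising-step : ∀ k u w z → raising u z * raisingPower k z w
               ≡ (𝟙 (lev u ≟ suc k + lev w) * 𝟙 (suc k ≟ dist w u) * cProd k) * ⟦ isDist G w z k ∧ isDist G u z 1 ⟧ᵇ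
  raising-step k u w z = begin
    raising u z * raisingPower k z w
      ≡⟨ solve 5 (λ p q r s g → (p :* q) :* ((r :* s) :* g) := g :* (p :* (q :* (r :* s)))) refl
           (𝟙 (1 ≟ dist u z)) (𝟙 (lev u ≟ suc (lev z))) (𝟙 (lev z ≟ k + lev w)) (𝟙 (k ≟ dist w z)) (cProd k) ⟩
    cProd k * (𝟙 (1 ≟ dist u z) * (𝟙 (lev u ≟ suc (lev z)) * (𝟙 (lev z ≟ k + lev w) * 𝟙 (k ≟ dist w z))))
      ≡⟨ cong (cProd k *_) (trans (sym (𝟙-×₄ (1 ≟ dist u z) (lev u ≟ suc (lev z)) (lev z ≟ k + lev w) (k ≟ dist w z)))
                           (trans (𝟙-⇔ extend restrict _ _)
                                  (𝟙-×₄ (lev u ≟ suc k + lev w) (suc k ≟ dist w u) (k ≟ dist w z) (1 ≟ dist u z)))) ⟩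
    cProd k * (𝟙 (lev u ≟ suc k + lev w) * (𝟙 (suc k ≟ dist w u) * (𝟙 (k ≟ dist w z) * 𝟙 (1 ≟ dist u z))))
      ≡⟨ solve 5 (λ p q r s g → g :* (p :* (q :* (r :* s))) := (p :* q :* g) :* (r :* s)) refl
           (𝟙 (lev u ≟ suc k + lev w)) (𝟙 (suc k ≟ dist w u)) (𝟙 (k ≟ dist w z)) (𝟙 (1 ≟ dist u z)) (cProd k) ⟩
    (𝟙 (lev u ≟ suc k + lev w) * 𝟙 (suc k ≟ dist w u) * cProd k) * (𝟙 (k ≟ dist w z) * 𝟙 (1 ≟ dist u z))
      ≡⟨ cong (𝟙 (lev u ≟ suc k + lev w) * 𝟙 (suc k ≟ dist w u) * cProd k *_) (sym (⟦isDist∧isDist⟧ u w z k)) ⟩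
    (𝟙 (lev u ≟ suc k + lev w) * 𝟙 (suc k ≟ dist w u) * cProd k) * ⟦ isDist G w z k ∧ isDist G u z 1 ⟧ᵇ ∎
    where
    extend : (1 ≡ dist u z) × (lev u ≡ suc (lev z)) × (lev z ≡ k + lev w) × (k ≡ dist w z) →
             (lev u ≡ suc k + lev w) × (suc k ≡ dist w u) × (k ≡ dist w z) × (1 ≡ dist u z)
    extend (u~z , up , zlev , wz) = ulev , ≤-antisym lower upper , wz , u~z
      where
      ulev : lev u ≡ suc k + lev w
      ulev = trans up (cong suc zlev)
      upper : dist w u ≤ suc k
      upper = subst (λ t → dist w u ≤ suc t) (sym wz) (dist-adj-≤ (adjacent⁻ u~z))
      lower : suc k ≤ dist w u
      lower = +-cancelʳ-≤ (lev w) (suc k) (dist w u)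
                (subst (_≤ dist w u + lev w) ulev (≤-trans (dist-triangle x w u) (≤-reflexive (+-comm (lev w) (dist w u)))))
    restrict : (lev u ≡ suc k + lev w) × (suc k ≡ dist w u) × (k ≡ dist w z) × (1 ≡ dist u z) →
               (1 ≡ dist u z) × (lev u ≡ suc (lev z)) × (lev z ≡ k + lev w) × (k ≡ dist w z)
    restrict (ulev , _ , wz , u~z) = u~z , trans ulev (cong suc (sym zlev)) , zlev , wz
      where
      zlev : lev z ≡ k + lev w
      zlev = ≤-antisym (≤-trans (dist-triangle x w z) (≤-reflexive (trans (cong (lev w +_) (sym wz)) (+-comm (lev w) k))))
                       (≤-pred (subst (_≤ suc (lev z)) ulev (dist-adj-≤ (adjacent⁻ u~z))))

  raising^-entry : ∀ k → raising ^ℕ k ≐ raisingPower k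
  raising^-entry zero u w with u ≟ᶠ w
  ... | yes refl = sym (cong₂ (λ p q → p * q * 1) (𝟙-yes refl (lev u ≟ lev u)) (𝟙-yes (sym (dist-refl u)) (0 ≟ dist u u)))
  ... | no u≢w   = sym (trans (cong (λ q → 𝟙 (lev u ≟ lev w) * q * 1) (𝟙-no (λ e → u≢w (sym (dist≡0⇒≡ (sym e)))) (0 ≟ dist w u)))
                              (cong (_* 1) (*-zeroʳ (𝟙 (lev u ≟ lev w)))))
  raising^-entry (suc k) u w = begin
    sum (λ z → raising u z * (raising ^ℕ k) z w)      ≡⟨ sum-cong-≗ (λ z → cong (raising u z *_) (raising^-entry k z w)) ⟩
    sum (λ z → raising u z * raisingPower k z w)      ≡⟨ sum-scaled-count _ (P * Q * cProd k) (λ z → isDist G w z k ∧ isDist G u z 1) (raising-step k u w) ⟩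
    (P * Q * cProd k) * count (λ z → isDist G w z k ∧ isDist G u z 1) ≡⟨ by-distance (lev u ≟ suc k + lev w) (suc k ≟ dist w u) ⟩
    raisingPower (suc k) u w ∎
    where
    P = 𝟙 (lev u ≟ suc k + lev w)
    Q = 𝟙 (suc k ≟ dist w u)
    by-distance : (d : Dec (lev u ≡ suc k + lev w)) (e : Dec (suc k ≡ dist w u)) →
                  (𝟙 d * 𝟙 e * cProd k) * count (λ z → isDist G w z k ∧ isDist G u z 1) ≡ 𝟙 d * 𝟙 e * cProd (suc k)
    by-distance (yes _) (yes wu) =
      trans (cong (1 * 1 * cProd k *_) (c-prop k w u (dist≡⇒Dist {w} {u} (sym wu)))) (*-assoc (1 * 1) (cProd k) (c (suc k)))
    by-distance (yes _) (no _)   = refl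
    by-distance (no _)  _        = refl

  n≢2+n : ∀ k → ¬ k ≡ suc (suc k)
  n≢2+n k = m≢1+n+m k {1}

  +2≡2+ : ∀ k → k + 2 ≡ suc (suc k)
  +2≡2+ k = +-comm k 2

  neighbour-dist : ∀ m u v z → 1 ≡ dist u z → m ≡ dist v z → suc m ≡ dist v u ⊎ suc m ≡ dist v u + 2
  neighbour-dist m u v z u~z vz with <-cmp (dist v u) m
  ... | tri≈ _ vu≡m _ = ⊥-elim (adj⇒dist≢ bip {v} (adjacent u~z) (trans vu≡m vz))
  ... | tri< vu<m _ _ = inj₂ (trans (cong suc (≤-antisym (subst (_≤ suc (dist v u)) (sym vz) (dist-adj-≤ (adjacent u~z))) vu<m))
                                    (sym (+2≡2+ (dist v u))))
  ... | tri> _ _ vu>m = inj₁ (≤-antisym vu>m (subst (λ t → dist v u ≤ suc t) (sym vz) (dist-adj-≤ (adjacent⁻ u~z))))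

  bcSum : ℕ → ℕ
  bcSum m = sumℕ m (λ j → b j * c (suc j))

  cProdBcSum : ℕ → ℕ
  cProdBcSum m = cProd m * bcSum (suc m)

  lowerRaise : ℕ → Matℕ n
  lowerRaise m = lowering ⊗ℕ (raising ^ℕ m ⊗ℕ E*ℕ 2)

  partialSum : ℕ → Matℕ n
  partialSum = horner raising lowerRaise

  -- The second summand needs ∂(v,u) + 2 = m, so the truncation in m ∸ 2 never matters.
  partialSumForm : ℕ → Matℕ n
  partialSumForm m u v =
    𝟙 (2 ≟ lev v) * 𝟙 (m ≟ lev u) * (𝟙 (m ≟ dist v u) * cProd m + 𝟙 (m ≟ dist v u + 2) * cProdBcSum (m ∸ 2))

  neighbour-at-distance-m : ∀ m u v z →
      𝟙 (1 ≟ dist u z) * (𝟙 (lev u ≟ suc (lev z)) * (𝟙 (2 ≟ lev v) * (𝟙 (m ≟ lev z) * 𝟙 (m ≟ dist v z))))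
    + 𝟙 (1 ≟ dist u z) * (𝟙 (lev z ≟ suc (lev u)) * (𝟙 (lev z ≟ m + lev v) * (𝟙 (m ≟ dist v z) * 𝟙 (2 ≟ lev v))))
    ≡ 𝟙 (2 ≟ lev v) * (𝟙 (suc m ≟ lev u) * (𝟙 (suc m ≟ dist v u) * (𝟙 (m ≟ dist v z) * 𝟙 (1 ≟ dist u z))))
    + 𝟙 (2 ≟ lev v) * (𝟙 (suc m ≟ lev u) * (𝟙 (suc m ≟ dist v u + 2) * (𝟙 (m ≟ dist v z) * 𝟙 (1 ≟ dist u z))))
  neighbour-at-distance-m m u v z = begin
    _                       ≡⟨ cong₂ _+_ (𝟙-×₅ (1 ≟ dist u z) (lev u ≟ suc (lev z)) (2 ≟ lev v) (m ≟ lev z) (m ≟ dist v z))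
                                         (𝟙-×₅ (1 ≟ dist u z) (lev z ≟ suc (lev u)) (lev z ≟ m + lev v) (m ≟ dist v z) (2 ≟ lev v)) ⟨
    𝟙 below + 𝟙 above       ≡⟨ 𝟙-⊎ below above (λ ((_ , up , _) , (_ , down , _)) → n≢2+n (lev u) (trans up (cong suc down))) ⟨
    𝟙 (below ⊎-dec above)   ≡⟨ 𝟙-⇔ to from (below ⊎-dec above) (further ⊎-dec closer) ⟩
    𝟙 (further ⊎-dec closer) ≡⟨ 𝟙-⊎ further closer (λ ((_ , _ , p , _) , (_ , _ , q , _)) →
                                   n≢2+n (dist v u) (trans (sym p) (trans q (+2≡2+ (dist v u))))) ⟩
    𝟙 further + 𝟙 closer    ≡⟨ cong₂ _+_ (𝟙-×₅ (2 ≟ lev v) (suc m ≟ lev u) (suc m ≟ dist v u) (m ≟ dist v z) (1 ≟ dist u z))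
                                         (𝟙-×₅ (2 ≟ lev v) (suc m ≟ lev u) (suc m ≟ dist v u + 2) (m ≟ dist v z) (1 ≟ dist u z)) ⟩
    _ ∎
    where
    below   = (1 ≟ dist u z) ×-dec ((lev u ≟ suc (lev z)) ×-dec ((2 ≟ lev v) ×-dec ((m ≟ lev z) ×-dec (m ≟ dist v z))))
    above   = (1 ≟ dist u z) ×-dec ((lev z ≟ suc (lev u)) ×-dec ((lev z ≟ m + lev v) ×-dec ((m ≟ dist v z) ×-dec (2 ≟ lev v))))
    further = (2 ≟ lev v) ×-dec ((suc m ≟ lev u) ×-dec ((suc m ≟ dist v u) ×-dec ((m ≟ dist v z) ×-dec (1 ≟ dist u z))))
    closer  = (2 ≟ lev v) ×-dec ((suc m ≟ lev u) ×-dec ((suc m ≟ dist v u + 2) ×-dec ((m ≟ dist v z) ×-dec (1 ≟ dist u z))))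

    2+m≡ : 2 ≡ lev v → lev z ≡ m + lev v → lev z ≡ suc (lev u) → suc m ≡ lev u
    2+m≡ v2 zlev up = suc-injective (trans (sym (trans (cong (m +_) (sym v2)) (+2≡2+ m))) (trans (sym zlev) up))

    to : _ → _
    to (inj₁ (u~z , down , v2 , zm , vz)) with neighbour-dist m u v z u~z vz
    ... | inj₁ p = inj₁ (v2 , trans (cong suc zm) (sym down) , p , vz , u~z)
    ... | inj₂ q = inj₂ (v2 , trans (cong suc zm) (sym down) , q , vz , u~z)
    to (inj₂ (u~z , up , zlev , vz , v2)) with neighbour-dist m u v z u~z vz
    ... | inj₁ p = inj₁ (v2 , 2+m≡ v2 zlev up , p , vz , u~z)
    ... | inj₂ q = inj₂ (v2 , 2+m≡ v2 zlev up , q , vz , u~z)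

    from′ : 2 ≡ lev v → suc m ≡ lev u → m ≡ dist v z → 1 ≡ dist u z → _
    from′ v2 um vz u~z with level-step u~z
    ... | inj₁ up   = inj₂ (u~z , up , trans up (trans (cong suc (sym um)) (trans (sym (+2≡2+ m)) (cong (m +_) v2))) , vz , v2)
    ... | inj₂ down = inj₁ (u~z , down , v2 , suc-injective (trans um down) , vz)

    from : _ → _
    from (inj₁ (v2 , um , _ , vz , u~z)) = from′ v2 um vz u~z
    from (inj₂ (v2 , um , _ , vz , u~z)) = from′ v2 um vz u~z

  neighbour-at-distance-m∸2 : ∀ m u v z →
      𝟙 (1 ≟ dist u z) * (𝟙 (lev u ≟ suc (lev z)) * (𝟙 (2 ≟ lev v) * (𝟙 (m ≟ lev z) * 𝟙 (m ≟ dist v z + 2))))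
    ≡ 𝟙 (2 ≟ lev v) * (𝟙 (suc m ≟ lev u) * (𝟙 (suc m ≟ dist v u + 2) * (𝟙 (m ∸ 2 ≟ dist v z) * 𝟙 (1 ≟ dist u z))))
  neighbour-at-distance-m∸2 m u v z = begin
    _              ≡⟨ 𝟙-×₅ (1 ≟ dist u z) (lev u ≟ suc (lev z)) (2 ≟ lev v) (m ≟ lev z) (m ≟ dist v z + 2) ⟨
    𝟙 below        ≡⟨ 𝟙-⇔ to from below closer ⟩
    𝟙 closer       ≡⟨ 𝟙-×₅ (2 ≟ lev v) (suc m ≟ lev u) (suc m ≟ dist v u + 2) (m ∸ 2 ≟ dist v z) (1 ≟ dist u z) ⟩
    _ ∎
    where
    below  = (1 ≟ dist u z) ×-dec ((lev u ≟ suc (lev z)) ×-dec ((2 ≟ lev v) ×-dec ((m ≟ lev z) ×-dec (m ≟ dist v z + 2))))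
    closer = (2 ≟ lev v) ×-dec ((suc m ≟ lev u) ×-dec ((suc m ≟ dist v u + 2) ×-dec ((m ∸ 2 ≟ dist v z) ×-dec (1 ≟ dist u z))))

    to : _ → _
    to (u~z , down , v2 , zm , vz) = v2 , um , trans (cong suc (trans vz (+2≡2+ _))) (trans (cong (λ t → suc (suc t)) (sym vu)) (sym (+2≡2+ _)))
                                   , trans (cong (_∸ 2) vz) (m+n∸n≡m (dist v z) 2) , u~z
      where
      um : suc m ≡ lev u
      um = trans (cong suc zm) (sym down)
      vu : dist v u ≡ suc (dist v z)
      vu = ≤-antisym (dist-adj-≤ (adjacent⁻ u~z))
             (≤-pred (≤-pred (subst₂ _≤_ (trans (sym um) (cong suc (trans vz (+2≡2+ _)))) (cong (_+ dist v u) (sym v2))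
                                     (dist-triangle x v u))))

    from : _ → _
    from (v2 , um , vu , vz , u~z) with level-step u~z
    ... | inj₁ up = ⊥-elim (too-far m refl (≤-pred (≤-pred (subst₂ _≤_ (trans up (cong suc (sym um))) (cong₂ _+_ (sym v2) (sym vz))
                                                                   (dist-triangle x v z)))))
      where
      too-far : ∀ k → k ≡ m → m ≤ m ∸ 2 → ⊥
      too-far zero    refl _    = 1+n≢0 (sym (suc-injective (trans vu (+2≡2+ _))))
      too-far (suc k) refl m≤m∸2 = <-irrefl refl (≤-trans m≤m∸2 (m∸n≤m k 1))
    ... | inj₂ down = u~z , down , v2 , suc-injective (trans um down) , m≡vz+2 m refl
      where
      m≡vz+2 : ∀ k → k ≡ m → m ≡ dist v z + 2
      m≡vz+2 zero                refl = ⊥-elim (1+n≢0 (sym (suc-injective (trans vu (+2≡2+ _)))))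
      m≡vz+2 (suc zero)          refl = ⊥-elim (1+n≢0 (trans u~z (trans (cong₂ dist u≡v z≡v) (dist-refl v))))
        where
        u≡v : u ≡ v
        u≡v = sym (dist≡0⇒≡ (suc-injective (suc-injective (trans (sym (+2≡2+ (dist v u))) (sym vu)))))
        z≡v : z ≡ v
        z≡v = sym (dist≡0⇒≡ (sym vz))
      m≡vz+2 (suc (suc k))       refl = trans (sym (m∸n+n≡m {suc (suc k)} {2} (s≤s (s≤s z≤n)))) (cong (_+ 2) vz)

  partialSum-summand : ∀ m u v z →
      raising u z * partialSumForm m z v + lowering u z * (raisingPower m z v * 𝟙 (2 ≟ lev v))
    ≡ (𝟙 (2 ≟ lev v) * 𝟙 (suc m ≟ lev u) * (𝟙 (suc m ≟ dist v u) * cProd m + 𝟙 (suc m ≟ dist v u + 2) * cProd m))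
        * ⟦ isDist G v z m ∧ isDist G u z 1 ⟧ᵇ
    + (𝟙 (2 ≟ lev v) * 𝟙 (suc m ≟ lev u) * (𝟙 (suc m ≟ dist v u + 2) * cProdBcSum (m ∸ 2)))
        * ⟦ isDist G v z (m ∸ 2) ∧ isDist G u z 1 ⟧ᵇ
  partialSum-summand m u v z = begin
    (a * r) * (v2 * zm * (vz * g + vz' * W)) + (a * l) * ((zlev * vz * g) * v2)
      ≡⟨ solve 10 (λ a r l v2 zm vz vz' zlev g W →
            (a :* r) :* (v2 :* zm :* (vz :* g :+ vz' :* W)) :+ (a :* l) :* ((zlev :* vz :* g) :* v2)
            := g :* (a :* (r :* (v2 :* (zm :* vz))) :+ a :* (l :* (zlev :* (vz :* v2)))) :+ W :* (a :* (r :* (v2 :* (zm :* vz')))))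
           refl a r l v2 zm vz vz' zlev g W ⟩
    g * (a * (r * (v2 * (zm * vz))) + a * (l * (zlev * (vz * v2)))) + W * (a * (r * (v2 * (zm * vz'))))
      ≡⟨ cong₂ (λ s t → g * s + W * t) (neighbour-at-distance-m m u v z) (neighbour-at-distance-m∸2 m u v z) ⟩
    g * (v2 * (um * (far * (vz * a))) + v2 * (um * (near * (vz * a)))) + W * (v2 * (um * (near * (vz'' * a))))
      ≡⟨ solve 9 (λ v2 um far near vz a vz'' g W →
            g :* (v2 :* (um :* (far :* (vz :* a))) :+ v2 :* (um :* (near :* (vz :* a)))) :+ W :* (v2 :* (um :* (near :* (vz'' :* a))))
            := (v2 :* um :* (far :* g :+ near :* g)) :* (vz :* a) :+ (v2 :* um :* (near :* W)) :* (vz'' :* a))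
           refl v2 um far near vz a vz'' g W ⟩
    (v2 * um * (far * g + near * g)) * (vz * a) + (v2 * um * (near * W)) * (vz'' * a)
      ≡⟨ cong₂ (λ s t → (v2 * um * (far * g + near * g)) * s + (v2 * um * (near * W)) * t)
               (sym (⟦isDist∧isDist⟧ u v z m)) (sym (⟦isDist∧isDist⟧ u v z (m ∸ 2))) ⟩
    (v2 * um * (far * g + near * g)) * ⟦ isDist G v z m ∧ isDist G u z 1 ⟧ᵇ
      + (v2 * um * (near * W)) * ⟦ isDist G v z (m ∸ 2) ∧ isDist G u z 1 ⟧ᵇ ∎
    where
    a = 𝟙 (1 ≟ dist u z)
    r = 𝟙 (lev u ≟ suc (lev z))
    l = 𝟙 (lev z ≟ suc (lev u))
    v2 = 𝟙 (2 ≟ lev v)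
    zm = 𝟙 (m ≟ lev z)
    zlev = 𝟙 (lev z ≟ m + lev v)
    vz = 𝟙 (m ≟ dist v z)
    vz' = 𝟙 (m ≟ dist v z + 2)
    vz'' = 𝟙 (m ∸ 2 ≟ dist v z)
    um = 𝟙 (suc m ≟ lev u)
    far = 𝟙 (suc m ≟ dist v u)
    near = 𝟙 (suc m ≟ dist v u + 2)
    g = cProd m
    W = cProdBcSum (m ∸ 2)

  descending-count : ∀ m u v → suc m ≡ dist v u + 2 →
      cProd m * count (λ z → isDist G v z m ∧ isDist G u z 1)
    + cProdBcSum (m ∸ 2) * count (λ z → isDist G v z (m ∸ 2) ∧ isDist G u z 1)
    ≡ cProdBcSum (m ∸ 1)
  descending-count m u v vu+2 with suc-injective (trans vu+2 (+2≡2+ (dist v u)))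
  ... | refl = at-distance (dist v u) refl
    where
    open Walks G using (reach-refl)
    at-distance : ∀ t → dist v u ≡ t →
        cProd (suc t) * count (λ z → isDist G v z (suc t) ∧ isDist G u z 1)
      + cProdBcSum (t ∸ 1) * count (λ z → isDist G v z (t ∸ 1) ∧ isDist G u z 1)
      ≡ cProdBcSum t
    at-distance zero vu with dist≡0⇒≡ {v} {u} vu
    ... | refl = begin
      cProd 1 * count (λ z → isDist G v z 1 ∧ isDist G v z 1) + cProdBcSum 0 * count (λ z → isDist G v z 0 ∧ isDist G v z 1)
        ≡⟨ cong₂ (λ s t → cProd 1 * s + cProdBcSum 0 * t) (b-prop 0 v v (reach-refl v)) (count-zero _ disjoint) ⟩
      cProd 1 * b 0 + cProdBcSum 0 * 0
        ≡⟨ solve 2 (λ c₁ b₀ → (con 1 :* c₁) :* b₀ :+ (con 1 :* (con 0 :+ b₀ :* c₁)) :* con 0 := con 1 :* (con 0 :+ b₀ :* c₁))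
                 refl (c 1) (b 0) ⟩
      cProdBcSum 0 ∎
      where
      disjoint : ∀ z → ⟦ isDist G v z 0 ∧ isDist G v z 1 ⟧ᵇ ≡ 0
      disjoint z = trans (⟦isDist∧isDist⟧ v v z 0)
        (trans (sym (𝟙-× (0 ≟ dist v z) (1 ≟ dist v z))) (𝟙-no (λ (p , q) → 1+n≢0 (trans q (sym p))) _))
    at-distance (suc t) vu = begin
      cProd (suc (suc t)) * count (λ z → isDist G v z (suc (suc t)) ∧ isDist G u z 1)
        + cProdBcSum t * count (λ z → isDist G v z t ∧ isDist G u z 1)
        ≡⟨ cong₂ (λ s r → cProd (suc (suc t)) * s + cProdBcSum t * r)
                 (b-prop (suc t) v u (dist≡⇒Dist vu)) (c-prop t v u (dist≡⇒Dist vu)) ⟩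
      cProd (suc (suc t)) * b (suc t) + cProdBcSum t * c (suc t)
        ≡⟨ solve 5 (λ g c₁ c₂ b₁ S → (g :* c₁ :* c₂) :* b₁ :+ (g :* S) :* c₁ := (g :* c₁) :* (S :+ b₁ :* c₂))
                 refl (cProd t) (c (suc t)) (c (suc (suc t))) (b (suc t)) (bcSum (suc t)) ⟩
      cProdBcSum (suc t) ∎

  lowerRaise-unfold : ∀ m u v → lowerRaise m u v ≡ sum (λ z → lowering u z * (raisingPower m z v * 𝟙 (2 ≟ lev v)))
  lowerRaise-unfold m u v =
    ⊗ℕ-congˡ lowering (λ z v → trans (E*ℕ-right 2 (raising ^ℕ m) z v) (cong (_* 𝟙 (2 ≟ lev v)) (raising^-entry m z v))) u v

  partialSum-entry : ∀ m → partialSum m ≐ partialSumForm m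
  partialSum-entry zero u v with 2 ≟ lev v | 0 ≟ lev u
  ... | no _    | _       = refl
  ... | yes _   | no _    = refl
  ... | yes v2  | yes u0 with dist≡0⇒≡ {x} {u} (sym u0)
  ... | refl rewrite 𝟙-no (λ e → 1+n≢0 (trans (trans v2 (dist-sym x v)) (sym e))) (0 ≟ dist v x)
                   | 𝟙-no (λ e → 1+n≢0 (sym (trans e (+2≡2+ _)))) (0 ≟ dist v x + 2) = refl
  partialSum-entry (suc m) u v = begin
    (raising ⊗ℕ partialSum m) u v + lowerRaise m u v
      ≡⟨ cong₂ _+_ (⊗ℕ-congˡ raising (partialSum-entry m) u v) (lowerRaise-unfold m u v) ⟩
    sum (λ z → raising u z * partialSumForm m z v) + sum (λ z → lowering u z * (raisingPower m z v * 𝟙 (2 ≟ lev v)))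
      ≡⟨ ∑-distrib-+ (λ z → raising u z * partialSumForm m z v) (λ z → lowering u z * (raisingPower m z v * 𝟙 (2 ≟ lev v))) ⟨
    sum (λ z → raising u z * partialSumForm m z v + lowering u z * (raisingPower m z v * 𝟙 (2 ≟ lev v)))
      ≡⟨ sum-cong-≗ (partialSum-summand m u v) ⟩
    sum (λ z → (Pre * (far * cProd m + near * cProd m)) * ⟦ p z ⟧ᵇ + (Pre * (near * W)) * ⟦ q z ⟧ᵇ)
      ≡⟨ sum-linear-count (Pre * (far * cProd m + near * cProd m)) (Pre * (near * W)) p q ⟩
    (Pre * (far * cProd m + near * cProd m)) * count p + (Pre * (near * W)) * count q
      ≡⟨ by-distance (suc m ≟ dist v u) (suc m ≟ dist v u + 2) ⟩
    partialSumForm (suc m) u v ∎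
    where
    Pre  = 𝟙 (2 ≟ lev v) * 𝟙 (suc m ≟ lev u)
    far  = 𝟙 (suc m ≟ dist v u)
    near = 𝟙 (suc m ≟ dist v u + 2)
    W    = cProdBcSum (m ∸ 2)
    p    = λ z → isDist G v z m ∧ isDist G u z 1
    q    = λ z → isDist G v z (m ∸ 2) ∧ isDist G u z 1
    by-distance : (d : Dec (suc m ≡ dist v u)) (e : Dec (suc m ≡ dist v u + 2)) →
      (Pre * (𝟙 d * cProd m + 𝟙 e * cProd m)) * count p + (Pre * (𝟙 e * W)) * count q
      ≡ Pre * (𝟙 d * cProd (suc m) + 𝟙 e * cProdBcSum (suc m ∸ 2))
    by-distance (yes p) (yes q) = ⊥-elim (n≢2+n (dist v u) (trans (sym p) (trans q (+2≡2+ _))))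
    by-distance (yes vu) (no _) =
      trans (cong (λ t → (Pre * (1 * cProd m + 0 * cProd m)) * t + (Pre * (0 * W)) * count q) (c-prop m v u (dist≡⇒Dist (sym vu))))
            (solve 5 (λ P g c₁ W cq → (P :* (con 1 :* g :+ con 0 :* g)) :* c₁ :+ (P :* (con 0 :* W)) :* cq
                                    := P :* (con 1 :* (g :* c₁) :+ con 0 :* (con 0)))
                   refl Pre (cProd m) (c (suc m)) W (count q))
    by-distance (no _) (yes vu+2) =
      trans (solve 5 (λ P g W cp cq → (P :* (con 0 :* g :+ con 1 :* g)) :* cp :+ (P :* (con 1 :* W)) :* cq
                                    := P :* (con 0 :+ con 1 :* (g :* cp :+ W :* cq)))
                   refl Pre (cProd m) W (count p) (count q))
            (cong (λ t → Pre * (0 + 1 * t)) (descending-count m u v vu+2))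
    by-distance (no _) (no _) = solve 5 (λ P g W cp cq → (P :* (con 0 :* g :+ con 0 :* g)) :* cp :+ (P :* (con 0 :* W)) :* cq
                                                      := P :* (con 0 :+ con 0))
                                        refl Pre (cProd m) W (count p) (count q)

  ⟦isDist³⟧ : ∀ u₁ w₁ j₁ u₂ w₂ j₂ u₃ w₃ j₃ →
              ⟦ isDist G u₁ w₁ j₁ ∧ (isDist G u₂ w₂ j₂ ∧ isDist G u₃ w₃ j₃) ⟧ᵇ
              ≡ 𝟙 ((j₁ ≟ dist u₁ w₁) ×-dec ((j₂ ≟ dist u₂ w₂) ×-dec (j₃ ≟ dist u₃ w₃)))
  ⟦isDist³⟧ u₁ w₁ j₁ u₂ w₂ j₂ u₃ w₃ j₃ = begin
    ⟦ isDist G u₁ w₁ j₁ ∧ (isDist G u₂ w₂ j₂ ∧ isDist G u₃ w₃ j₃) ⟧ᵇ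
      ≡⟨ trans (⟦∧⟧ᵇ (isDist G u₁ w₁ j₁) _) (cong (⟦ isDist G u₁ w₁ j₁ ⟧ᵇ *_) (⟦∧⟧ᵇ (isDist G u₂ w₂ j₂) _)) ⟩
    ⟦ isDist G u₁ w₁ j₁ ⟧ᵇ * (⟦ isDist G u₂ w₂ j₂ ⟧ᵇ * ⟦ isDist G u₃ w₃ j₃ ⟧ᵇ)
      ≡⟨ cong₂ _*_ (⟦isDist⟧ u₁ w₁ j₁) (cong₂ _*_ (⟦isDist⟧ u₂ w₂ j₂) (⟦isDist⟧ u₃ w₃ j₃)) ⟩
    𝟙 (j₁ ≟ dist u₁ w₁) * (𝟙 (j₂ ≟ dist u₂ w₂) * 𝟙 (j₃ ≟ dist u₃ w₃))
      ≡⟨ 𝟙-×₃ (j₁ ≟ dist u₁ w₁) (j₂ ≟ dist u₂ w₂) (j₃ ≟ dist u₃ w₃) ⟨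
    𝟙 ((j₁ ≟ dist u₁ w₁) ×-dec ((j₂ ≟ dist u₂ w₂) ×-dec (j₃ ≟ dist u₃ w₃))) ∎

  upperNeighbours lowerNeighbours levelNeighbours : ℕ → Fin n → Fin n → Fin n → Bool
  upperNeighbours m u v w = isDist G x w (suc (suc m)) ∧ (isDist G u w 1 ∧ isDist G v w m)
  lowerNeighbours m u v w = isDist G x w 1 ∧ (isDist G v w 1 ∧ isDist G u w m)
  levelNeighbours m u v w = isDist G x w m ∧ (isDist G v w m ∧ isDist G u w 1)

  lowerRaise-entry : ∀ m u v → lowerRaise m u v ≡ 𝟙 (2 ≟ lev v) * 𝟙 (suc m ≟ lev u) * (cProd m * count (upperNeighbours m u v))
  lowerRaise-entry m u v =
    trans (lowerRaise-unfold m u v)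
    (trans (sum-scaled-count _ (𝟙 (2 ≟ lev v) * 𝟙 (suc m ≟ lev u) * cProd m) (upperNeighbours m u v) summand)
           (*-assoc (𝟙 (2 ≟ lev v) * 𝟙 (suc m ≟ lev u)) (cProd m) _))
    where
    summand : ∀ w → lowering u w * (raisingPower m w v * 𝟙 (2 ≟ lev v))
                    ≡ 𝟙 (2 ≟ lev v) * 𝟙 (suc m ≟ lev u) * cProd m * ⟦ upperNeighbours m u v w ⟧ᵇ
    summand w = begin
      lowering u w * (raisingPower m w v * 𝟙 (2 ≟ lev v))
        ≡⟨ solve 6 (λ a l wl e v2 g → (a :* l) :* ((wl :* e :* g) :* v2) := g :* (a :* (l :* (wl :* (e :* v2))))) refl
                 (𝟙 (1 ≟ dist u w)) (𝟙 (lev w ≟ suc (lev u))) (𝟙 (lev w ≟ m + lev v)) (𝟙 (m ≟ dist v w)) (𝟙 (2 ≟ lev v)) (cProd m) ⟩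
      cProd m * (𝟙 (1 ≟ dist u w) * (𝟙 (lev w ≟ suc (lev u)) * (𝟙 (lev w ≟ m + lev v) * (𝟙 (m ≟ dist v w) * 𝟙 (2 ≟ lev v)))))
        ≡⟨ cong (cProd m *_) (trans (sym (𝟙-×₅ (1 ≟ dist u w) (lev w ≟ suc (lev u)) (lev w ≟ m + lev v) (m ≟ dist v w) (2 ≟ lev v)))
                             (trans (𝟙-⇔ to from _ _)
                                    (𝟙-×₅ (2 ≟ lev v) (suc m ≟ lev u) (suc (suc m) ≟ lev w) (1 ≟ dist u w) (m ≟ dist v w)))) ⟩
      cProd m * (𝟙 (2 ≟ lev v) * (𝟙 (suc m ≟ lev u) * (𝟙 (suc (suc m) ≟ lev w) * (𝟙 (1 ≟ dist u w) * 𝟙 (m ≟ dist v w)))))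
        ≡⟨ solve 6 (λ v2 um wl a e g → g :* (v2 :* (um :* (wl :* (a :* e)))) := (v2 :* um :* g) :* (wl :* (a :* e))) refl
                 (𝟙 (2 ≟ lev v)) (𝟙 (suc m ≟ lev u)) (𝟙 (suc (suc m) ≟ lev w)) (𝟙 (1 ≟ dist u w)) (𝟙 (m ≟ dist v w)) (cProd m) ⟩
      𝟙 (2 ≟ lev v) * 𝟙 (suc m ≟ lev u) * cProd m * (𝟙 (suc (suc m) ≟ lev w) * (𝟙 (1 ≟ dist u w) * 𝟙 (m ≟ dist v w)))
        ≡⟨ cong (𝟙 (2 ≟ lev v) * 𝟙 (suc m ≟ lev u) * cProd m *_)
                (trans (sym (𝟙-×₃ (suc (suc m) ≟ lev w) (1 ≟ dist u w) (m ≟ dist v w))) (sym (⟦isDist³⟧ x w _ u w 1 v w m))) ⟩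
      𝟙 (2 ≟ lev v) * 𝟙 (suc m ≟ lev u) * cProd m * ⟦ upperNeighbours m u v w ⟧ᵇ ∎
      where
      to : _ → _
      to (u~w , up , wlev , vw , v2) = v2 , suc-injective (trans (sym (trans (cong (m +_) (sym v2)) (+2≡2+ m))) (trans (sym wlev) up))
                                     , trans (sym (+2≡2+ m)) (trans (cong (m +_) v2) (sym wlev)) , u~w , vw
      from : _ → _
      from (v2 , um , wm , u~w , vw) = u~w , trans (sym wm) (cong suc um) , trans (sym wm) (trans (sym (+2≡2+ m)) (cong (m +_) v2)) , vw , v2

  raiseLower-entry : ∀ m u v → (raising ^ℕ m ⊗ℕ (lowering ⊗ℕ E*ℕ 2)) u v
                               ≡ 𝟙 (2 ≟ lev v) * 𝟙 (suc m ≟ lev u) * (cProd m * count (lowerNeighbours m u v))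
  raiseLower-entry m u v =
    trans (sum-cong-≗ (λ w → cong₂ _*_ (raising^-entry m u w) (E*ℕ-right 2 lowering w v)))
    (trans (sum-scaled-count _ (𝟙 (2 ≟ lev v) * 𝟙 (suc m ≟ lev u) * cProd m) (lowerNeighbours m u v) summand)
           (*-assoc (𝟙 (2 ≟ lev v) * 𝟙 (suc m ≟ lev u)) (cProd m) _))
    where
    summand : ∀ w → raisingPower m u w * (lowering w v * 𝟙 (2 ≟ lev v))
                    ≡ 𝟙 (2 ≟ lev v) * 𝟙 (suc m ≟ lev u) * cProd m * ⟦ lowerNeighbours m u v w ⟧ᵇ
    summand w = begin
      raisingPower m u w * (lowering w v * 𝟙 (2 ≟ lev v))
        ≡⟨ solve 6 (λ ul e a vl v2 g → (ul :* e :* g) :* ((a :* vl) :* v2) := g :* (ul :* (e :* (a :* (vl :* v2))))) refl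
                 (𝟙 (lev u ≟ m + lev w)) (𝟙 (m ≟ dist w u)) (𝟙 (1 ≟ dist w v)) (𝟙 (lev v ≟ suc (lev w))) (𝟙 (2 ≟ lev v)) (cProd m) ⟩
      cProd m * (𝟙 (lev u ≟ m + lev w) * (𝟙 (m ≟ dist w u) * (𝟙 (1 ≟ dist w v) * (𝟙 (lev v ≟ suc (lev w)) * 𝟙 (2 ≟ lev v)))))
        ≡⟨ cong (cProd m *_) (trans (sym (𝟙-×₅ (lev u ≟ m + lev w) (m ≟ dist w u) (1 ≟ dist w v) (lev v ≟ suc (lev w)) (2 ≟ lev v)))
                             (trans (𝟙-⇔ to from _ _)
                                    (𝟙-×₅ (2 ≟ lev v) (suc m ≟ lev u) (1 ≟ lev w) (1 ≟ dist v w) (m ≟ dist u w)))) ⟩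
      cProd m * (𝟙 (2 ≟ lev v) * (𝟙 (suc m ≟ lev u) * (𝟙 (1 ≟ lev w) * (𝟙 (1 ≟ dist v w) * 𝟙 (m ≟ dist u w)))))
        ≡⟨ solve 6 (λ v2 um wl a e g → g :* (v2 :* (um :* (wl :* (a :* e)))) := (v2 :* um :* g) :* (wl :* (a :* e))) refl
                 (𝟙 (2 ≟ lev v)) (𝟙 (suc m ≟ lev u)) (𝟙 (1 ≟ lev w)) (𝟙 (1 ≟ dist v w)) (𝟙 (m ≟ dist u w)) (cProd m) ⟩
      𝟙 (2 ≟ lev v) * 𝟙 (suc m ≟ lev u) * cProd m * (𝟙 (1 ≟ lev w) * (𝟙 (1 ≟ dist v w) * 𝟙 (m ≟ dist u w)))
        ≡⟨ cong (𝟙 (2 ≟ lev v) * 𝟙 (suc m ≟ lev u) * cProd m *_)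
                (trans (sym (𝟙-×₃ (1 ≟ lev w) (1 ≟ dist v w) (m ≟ dist u w))) (sym (⟦isDist³⟧ x w 1 v w 1 u w m))) ⟩
      𝟙 (2 ≟ lev v) * 𝟙 (suc m ≟ lev u) * cProd m * ⟦ lowerNeighbours m u v w ⟧ᵇ ∎
      where
      to : _ → _
      to (ul , wu , w~v , vl , v2) = v2 , trans (sym (trans (cong (m +_) (sym wl)) (+-comm m 1))) (sym ul) , wl
                                   , trans w~v (dist-sym w v) , trans wu (dist-sym w u)
        where
        wl : 1 ≡ lev w
        wl = suc-injective (trans v2 vl)
      from : _ → _
      from (v2 , um , wl , v~w , uw) = trans (sym um) (trans (+-comm 1 m) (cong (m +_) wl)) , trans uw (dist-sym u w)
                                     , trans v~w (dist-sym v w) , trans (sym v2) (cong suc wl) , v2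

  raisingE₂-entry : ∀ k u v → (raising ^ℕ k ⊗ℕ E*ℕ 2) u v ≡ raisingPower k u v * 𝟙 (2 ≟ lev v)
  raisingE₂-entry k u v = trans (E*ℕ-right 2 (raising ^ℕ k) u v) (cong (_* 𝟙 (2 ≟ lev v)) (raising^-entry k u v))

  module AtEntry (k : ℕ) (u v : Fin n) where
    i m : ℕ
    i = suc (suc k)
    m = suc k

    sumEntry lrEntry rlEntry rEntry : ℕ
    sumEntry = (raising ⊗ℕ partialSum m) u v
    lrEntry  = lowerRaise m u v
    rlEntry  = (raising ^ℕ m ⊗ℕ (lowering ⊗ℕ E*ℕ 2)) u v
    rEntry   = (raising ^ℕ k ⊗ℕ E*ℕ 2) u v

    upper lower level : ℕ
    upper = count (upperNeighbours m u v)
    lower = count (lowerNeighbours m u v)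
    level = count (levelNeighbours m u v)

    data EntryCase : Set where
      distance-i   : Dist G x v 2 → Dist G x u i → Dist G v u i →
                     lrEntry ≡ cProd m * upper → rlEntry ≡ cProd m * lower → rEntry ≡ 0 →
                     sumEntry + lrEntry ≡ cProd i → upper + level ≡ c i → EntryCase
      distance-i∸2 : lrEntry ≡ cProd m * b i → rlEntry ≡ cProd m * c 2 → rEntry ≡ cProd k →
                     sumEntry + lrEntry ≡ cProdBcSum k → EntryCase
      vanishing    : lrEntry ≡ 0 → rlEntry ≡ 0 → rEntry ≡ 0 → sumEntry ≡ 0 → EntryCase

    prefactor : ∀ {t} → 2 ≡ lev v → i ≡ lev u → 𝟙 (2 ≟ lev v) * 𝟙 (i ≟ lev u) * t ≡ t
    prefactor {t} v2 ui = trans (cong (_* t) (cong₂ _*_ (𝟙-yes v2 (2 ≟ lev v)) (𝟙-yes ui (i ≟ lev u)))) (*-identityˡ t)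

    at-distance-i : 2 ≡ lev v → i ≡ lev u → i ≡ dist v u → EntryCase
    at-distance-i v2 ui vu =
      distance-i (dist≡⇒Dist (sym v2)) (dist≡⇒Dist (sym ui)) (dist≡⇒Dist (sym vu))
        (trans (lowerRaise-entry m u v) (prefactor v2 ui))
        (trans (raiseLower-entry m u v) (prefactor v2 ui))
        (trans (raisingE₂-entry k u v)
          (trans (cong (λ t → 𝟙 (lev u ≟ k + lev v) * t * cProd k * 𝟙 (2 ≟ lev v)) (𝟙-no (λ e → n≢2+n k (trans e (sym vu))) (k ≟ dist v u)))
                 (solve 3 (λ a g d → a :* con 0 :* g :* d := con 0) refl (𝟙 (lev u ≟ k + lev v)) (cProd k) (𝟙 (2 ≟ lev v)))))
        (trans (partialSum-entry i u v) (trans (prefactor v2 ui)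
          (trans (cong₂ (λ s t → s * cProd i + t * cProdBcSum k)
                        (𝟙-yes vu (i ≟ dist v u)) (𝟙-no (λ e → n≢2+n (dist v u) (trans (sym vu) (trans e (+2≡2+ _)))) (i ≟ dist v u + 2)))
                 (solve 2 (λ g W → con 1 :* g :+ con 0 :* W := g) refl (cProd i) (cProdBcSum k)))))
        (trans (sym (count-split _ (upperNeighbours m u v) (levelNeighbours m u v) split)) (c-prop m v u (dist≡⇒Dist (sym vu))))
      where
      split : ∀ w → ⟦ isDist G v w m ∧ isDist G u w 1 ⟧ᵇ ≡ ⟦ upperNeighbours m u v w ⟧ᵇ + ⟦ levelNeighbours m u v w ⟧ᵇ
      split w = begin
        ⟦ isDist G v w m ∧ isDist G u w 1 ⟧ᵇ        ≡⟨ trans (⟦isDist∧isDist⟧ u v w m) (sym (𝟙-× (m ≟ dist v w) (1 ≟ dist u w))) ⟩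
        𝟙 ((m ≟ dist v w) ×-dec (1 ≟ dist u w))      ≡⟨ 𝟙-⇔ to from _ (above ⊎-dec beside) ⟩
        𝟙 (above ⊎-dec beside)                       ≡⟨ 𝟙-⊎ above beside (λ ((wl , _) , (wl' , _)) → n≢2+n m (trans wl' (sym wl))) ⟩
        𝟙 above + 𝟙 beside                           ≡⟨ cong₂ _+_ (⟦isDist³⟧ x w (suc i) u w 1 v w m) (⟦isDist³⟧ x w m v w m u w 1) ⟨
        ⟦ upperNeighbours m u v w ⟧ᵇ + ⟦ levelNeighbours m u v w ⟧ᵇ ∎
        where
        above  = (suc i ≟ lev w) ×-dec ((1 ≟ dist u w) ×-dec (m ≟ dist v w))
        beside = (m ≟ lev w) ×-dec ((m ≟ dist v w) ×-dec (1 ≟ dist u w))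
        to : _ → _
        to (vw , u~w) with level-step u~w
        ... | inj₁ up   = inj₁ (sym (trans up (cong suc (sym ui))) , u~w , vw)
        ... | inj₂ down = inj₂ (suc-injective (trans ui down) , vw , u~w)
        from : _ → _
        from (inj₁ (_ , u~w , vw)) = vw , u~w
        from (inj₂ (_ , vw , u~w)) = vw , u~w

    at-distance-i∸2 : 2 ≡ lev v → i ≡ lev u → ¬ i ≡ dist v u → i ≡ dist v u + 2 → EntryCase
    at-distance-i∸2 v2 ui ¬vu vu+2 =
      distance-i∸2
        (trans (lowerRaise-entry m u v) (trans (prefactor v2 ui) (cong (cProd m *_) upper≡b)))
        (trans (raiseLower-entry m u v) (trans (prefactor v2 ui) (cong (cProd m *_) lower≡c₂)))
        (trans (raisingE₂-entry k u v)
          (trans (cong₂ (λ s t → s * t * cProd k * 𝟙 (2 ≟ lev v))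
                        (𝟙-yes (trans (sym ui) (trans (sym (+2≡2+ k)) (cong (k +_) v2))) (lev u ≟ k + lev v))
                        (𝟙-yes (sym vu≡k) (k ≟ dist v u)))
          (trans (cong (λ t → 1 * 1 * cProd k * t) (𝟙-yes v2 (2 ≟ lev v)))
                 (solve 1 (λ g → con 1 :* con 1 :* g :* con 1 := g) refl (cProd k)))))
        (trans (partialSum-entry i u v) (trans (prefactor v2 ui)
          (trans (cong₂ (λ s t → s * cProd i + t * cProdBcSum k) (𝟙-no ¬vu (i ≟ dist v u)) (𝟙-yes vu+2 (i ≟ dist v u + 2)))
                 (solve 2 (λ g W → con 0 :* g :+ con 1 :* W := W) refl (cProd i) (cProdBcSum k)))))
      where
      vu≡k : dist v u ≡ k
      vu≡k = suc-injective (suc-injective (trans (sym (+2≡2+ (dist v u))) (sym vu+2)))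

      upper≡b : upper ≡ b i
      upper≡b = trans (count-cong (upperNeighbours m u v) (λ w → isDist G x w (suc i) ∧ isDist G u w 1) pointwise)
                      (b-prop i x u (dist≡⇒Dist (sym ui)))
        where
        pointwise : ∀ w → ⟦ upperNeighbours m u v w ⟧ᵇ ≡ ⟦ isDist G x w (suc i) ∧ isDist G u w 1 ⟧ᵇ
        pointwise w = trans (⟦isDist³⟧ x w (suc i) u w 1 v w m)
          (trans (𝟙-⇔ (λ (wl , u~w , _) → wl , u~w) from _ ((suc i ≟ lev w) ×-dec (1 ≟ dist u w)))
                 (trans (𝟙-× (suc i ≟ lev w) (1 ≟ dist u w)) (sym (⟦isDist∧isDist⟧ u x w (suc i)))))
          where
          from : _ → _
          from (wl , u~w) = wl , u~w , ≤-antisym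
            (≤-pred (≤-pred (subst₂ _≤_ (sym wl) (cong (_+ dist v w) (sym v2)) (dist-triangle x v w))))
            (subst (λ t → dist v w ≤ suc t) vu≡k (dist-adj-≤ (adjacent u~w)))

      lower≡c₂ : lower ≡ c 2
      lower≡c₂ = trans (count-cong (lowerNeighbours m u v) (λ w → isDist G x w 1 ∧ isDist G v w 1) pointwise)
                       (c-prop 1 x v (dist≡⇒Dist (sym v2)))
        where
        pointwise : ∀ w → ⟦ lowerNeighbours m u v w ⟧ᵇ ≡ ⟦ isDist G x w 1 ∧ isDist G v w 1 ⟧ᵇ
        pointwise w = trans (⟦isDist³⟧ x w 1 v w 1 u w m)
          (trans (𝟙-⇔ (λ (wl , v~w , _) → wl , v~w) from _ ((1 ≟ lev w) ×-dec (1 ≟ dist v w)))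
                 (trans (𝟙-× (1 ≟ lev w) (1 ≟ dist v w)) (sym (⟦isDist∧isDist⟧ v x w 1))))
          where
          from : _ → _
          from (wl , v~w) = wl , v~w , ≤-antisym
            (subst (m ≤_) (dist-sym w u) (≤-pred (subst₂ _≤_ (sym ui) (cong (_+ dist w u) (sym wl)) (dist-triangle x w u))))
            (subst (λ t → dist u w ≤ suc t) (trans (dist-sym u v) vu≡k) (dist-adj-≤ (adjacent v~w)))

    distanceFactor : ℕ
    distanceFactor = 𝟙 (i ≟ dist v u) * cProd i + 𝟙 (i ≟ dist v u + 2) * cProdBcSum k

    off-support : 𝟙 (2 ≟ lev v) * 𝟙 (i ≟ lev u) ≡ 0 → rEntry ≡ 0 → EntryCase
    off-support pre≡0 r≡0 = vanishing
      (trans (lowerRaise-entry m u v) (cong (_* (cProd m * upper)) pre≡0))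
      (trans (raiseLower-entry m u v) (cong (_* (cProd m * lower)) pre≡0))
      r≡0
      (m+n≡0⇒m≡0 sumEntry (trans (partialSum-entry i u v) (cong (_* distanceFactor) pre≡0)))

    no-geodesic : 2 ≡ lev v → i ≡ lev u → ¬ i ≡ dist v u → ¬ i ≡ dist v u + 2 → EntryCase
    no-geodesic v2 ui ¬vu ¬vu+2 = vanishing
      (trans (lowerRaise-entry m u v) (trans (prefactor v2 ui) (trans (cong (cProd m *_) upper≡0) (*-zeroʳ (cProd m)))))
      (trans (raiseLower-entry m u v) (trans (prefactor v2 ui) (trans (cong (cProd m *_) lower≡0) (*-zeroʳ (cProd m)))))
      (trans (raisingE₂-entry k u v)
        (trans (cong (λ t → 𝟙 (lev u ≟ k + lev v) * t * cProd k * 𝟙 (2 ≟ lev v))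
                     (𝟙-no (λ e → ¬vu+2 (trans (sym (+2≡2+ k)) (cong (_+ 2) e))) (k ≟ dist v u)))
               (solve 3 (λ a g d → a :* con 0 :* g :* d := con 0) refl (𝟙 (lev u ≟ k + lev v)) (cProd k) (𝟙 (2 ≟ lev v)))))
      (m+n≡0⇒m≡0 sumEntry (trans (partialSum-entry i u v) (trans (prefactor v2 ui)
        (cong₂ (λ s t → s * cProd i + t * cProdBcSum k) (𝟙-no ¬vu (i ≟ dist v u)) (𝟙-no ¬vu+2 (i ≟ dist v u + 2))))))
      where
      not-at-i-or-i∸2 : suc m ≡ dist v u ⊎ suc m ≡ dist v u + 2 → ⊥
      not-at-i-or-i∸2 (inj₁ vu)   = ¬vu vu
      not-at-i-or-i∸2 (inj₂ vu+2) = ¬vu+2 vu+2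

      upper≡0 : upper ≡ 0
      upper≡0 = count-zero (upperNeighbours m u v) (λ w → trans (⟦isDist³⟧ x w (suc i) u w 1 v w m)
        (𝟙-no (λ (_ , u~w , vw) → not-at-i-or-i∸2 (neighbour-dist m u v w u~w vw)) _))

      lower≡0 : lower ≡ 0
      lower≡0 = count-zero (lowerNeighbours m u v) (λ w → trans (⟦isDist³⟧ x w 1 v w 1 u w m)
        (𝟙-no (λ (_ , v~w , uw) → not-at-i-or-i∸2 (symmetric (neighbour-dist m v u w v~w uw))) _))
        where
        symmetric : suc m ≡ dist u v ⊎ suc m ≡ dist u v + 2 → suc m ≡ dist v u ⊎ suc m ≡ dist v u + 2
        symmetric (inj₁ e) = inj₁ (trans e (dist-sym u v))
        symmetric (inj₂ e) = inj₂ (trans e (cong (_+ 2) (dist-sym u v)))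

    classify : EntryCase
    classify with 2 ≟ lev v | i ≟ lev u
    ... | no ¬v2 | _ = off-support (cong (_* 𝟙 (i ≟ lev u)) (𝟙-no ¬v2 (2 ≟ lev v)))
      (trans (raisingE₂-entry k u v) (trans (cong (raisingPower k u v *_) (𝟙-no ¬v2 (2 ≟ lev v))) (*-zeroʳ (raisingPower k u v))))
    ... | yes v2 | no ¬ui = off-support (trans (cong (𝟙 (2 ≟ lev v) *_) (𝟙-no ¬ui (i ≟ lev u))) (*-zeroʳ (𝟙 (2 ≟ lev v))))
      (trans (raisingE₂-entry k u v) (cong (λ t → t * 𝟙 (k ≟ dist v u) * cProd k * 𝟙 (2 ≟ lev v))
        (𝟙-no (λ e → ¬ui (trans (sym (+2≡2+ k)) (trans (cong (k +_) v2) (sym e)))) (lev u ≟ k + lev v))))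
    ... | yes v2 | yes ui with i ≟ dist v u | i ≟ dist v u + 2
    ...   | yes vu  | _         = at-distance-i v2 ui vu
    ...   | no ¬vu  | yes vu+2  = at-distance-i∸2 v2 ui ¬vu vu+2
    ...   | no ¬vu  | no ¬vu+2  = no-geodesic v2 ui ¬vu ¬vu+2

module RingIdentities {c ℓ} (R : CommutativeRing c ℓ) where

  open CommutativeRing R
  open IntegerEmbedding R using (solve; _:=_; _:+_; _:*_; :-_)

  identity-at-distance-i : ∀ α β g X Y Y' cᵢ S → S + g * X ≈ g * cᵢ → X + Y' ≈ cᵢ → α + β * Y ≈ Y' →
                           α * (g * X) ≈ (cᵢ + - α) * S + (- (cᵢ * β)) * (g * Y)
  identity-at-distance-i α β g X Y Y' cᵢ S S+gX≈gcᵢ X+Y'≈cᵢ α+βY≈Y' = trans identity (sym substitute)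
    where
    cᵢ' = X + (α + β * Y)
    S'  = g * cᵢ' + - (g * X)
    cᵢ≈ : cᵢ ≈ cᵢ'
    cᵢ≈ = trans (sym X+Y'≈cᵢ) (+-congˡ (sym α+βY≈Y'))
    S≈ : S ≈ S'
    S≈ = trans (solve 3 (λ s g x → s := (s :+ g :* x) :+ :- (g :* x)) refl S g X) (+-congʳ (trans S+gX≈gcᵢ (*-congˡ cᵢ≈)))
    substitute : (cᵢ + - α) * S + (- (cᵢ * β)) * (g * Y) ≈ (cᵢ' + - α) * S' + (- (cᵢ' * β)) * (g * Y)
    substitute = +-cong (*-cong (+-congʳ cᵢ≈) S≈) (*-congʳ (-‿cong (*-congʳ cᵢ≈)))
    identity : α * (g * X) ≈ (cᵢ' + - α) * S' + (- (cᵢ' * β)) * (g * Y)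
    identity = solve 5 (λ a b g x y → a :* (g :* x) :=
                 ((x :+ (a :+ b :* y)) :+ :- a) :* (g :* (x :+ (a :+ b :* y)) :+ :- (g :* x))
                 :+ (:- ((x :+ (a :+ b :* y)) :* b)) :* (g :* y)) refl α β g X Y

  identity-at-distance-i∸2 : ∀ α β cᵢ cₘ c₂ bᵢ Σ g' g S → g ≈ g' * cₘ → S + g * bᵢ ≈ g' * Σ →
    α * (g * bᵢ) ≈ ((cᵢ + - α) * S + (- (cᵢ * β)) * (g * c₂)) + ((cᵢ * cₘ) * (β * c₂ + bᵢ) + (α + - cᵢ) * Σ) * g'
  identity-at-distance-i∸2 α β cᵢ cₘ c₂ bᵢ Σ g' g S g≈g'cₘ S+gbᵢ≈g'Σ = trans (*-congˡ (*-congʳ g≈g'cₘ)) (trans identity (sym substitute))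
    where
    S' = g' * Σ + - (g' * cₘ * bᵢ)
    K  = (cᵢ * cₘ) * (β * c₂ + bᵢ) + (α + - cᵢ) * Σ
    S≈ : S ≈ S'
    S≈ = trans (solve 3 (λ s g b → s := (s :+ g :* b) :+ :- (g :* b)) refl S g bᵢ) (+-cong S+gbᵢ≈g'Σ (-‿cong (*-congʳ g≈g'cₘ)))
    substitute : ((cᵢ + - α) * S + (- (cᵢ * β)) * (g * c₂)) + K * g' ≈ ((cᵢ + - α) * S' + (- (cᵢ * β)) * (g' * cₘ * c₂)) + K * g'
    substitute = +-congʳ (+-cong (*-congˡ S≈) (*-congˡ (*-congʳ g≈g'cₘ)))
    identity : α * (g' * cₘ * bᵢ) ≈ ((cᵢ + - α) * S' + (- (cᵢ * β)) * (g' * cₘ * c₂)) + K * g'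
    identity = solve 8 (λ a b ci cm c2 bi s g' → a :* (g' :* cm :* bi) :=
                 ((ci :+ :- a) :* (g' :* s :+ :- (g' :* cm :* bi)) :+ (:- (ci :* b)) :* (g' :* cm :* c2))
                 :+ ((ci :* cm) :* (b :* c2 :+ bi) :+ (a :+ :- ci) :* s) :* g') refl α β cᵢ cₘ c₂ bᵢ Σ g'

module EntryIdentity {c ℓ} (F : CharZeroField c ℓ) {n : ℕ} (G : Graph n) (D : ℕ) (b cc : ℕ → ℕ) (x : Fin n)
                     (drg : IsDRG G b cc) (diam : HasDiameter G D) (bip : Bipartite G) where

  open import Data.Fin.Properties using (_≟_)
  open import Data.Bool using (true; false)
  open import Relation.Nullary.Decidable using (⌊_⌋)
  import Relation.Binary.PropositionalEquality as ≡
  open import Data.Integer using (+_)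
  open Counting
  open NatMatrices

  open CharZeroField F hiding (zero)
  open Matrices F
  open GraphMats G D x
  open IntegerEmbedding cring using (ι-+; ι-*; solve; _:=_; _:+_; _:*_; con)
  open MatrixTransport F
  open Entries G D b cc x drg diam bip

  A≋ : A ≋ ιM Aℕ
  A≋ u v = boolF≈ι (Graph.adj G u v)

  E*≋ : ∀ j → E* j ≋ ιM (E*ℕ j)
  E*≋ j u v with ⌊ u ≟ v ⌋
  ... | true  = boolF≈ι (isDist G x u j)
  ... | false = refl

  E*AE*≋ : ∀ a h → (E* a ⊗ (A ⊗ E* h)) ≋ ιM (E*ℕ a ⊗ℕ (Aℕ ⊗ℕ E*ℕ h))
  E*AE*≋ a h = ⊗-ιM {M' = E*ℕ a} {Aℕ ⊗ℕ E*ℕ h} (E*≋ a) (⊗-ιM {M' = Aℕ} {E*ℕ h} A≋ (E*≋ h))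

  L≋ : L ≋ ιM lowering
  L≋ = ιM-≐ {M' = Lℕ} (sumRange-ιM 1 D (λ h → E*AE*≋ (h ∸ 1) h)) Lℕ≐lowering

  R≋ : R ≋ ιM raising
  R≋ = ιM-≐ {M' = Rℕ} (sumRange-ιM 0 D (λ h → E*AE*≋ (suc h) h)) Rℕ≐raising

  R^^≋ : ∀ j → (R ^^ j) ≋ ιM (raising ^ℕ j)
  R^^≋ = ^^-ιM R≋

  R^^E₂≋ : ∀ j → ((R ^^ j) ⊗ E* 2) ≋ ιM (raising ^ℕ j ⊗ℕ E*ℕ 2)
  R^^E₂≋ j = ⊗-ιM {M' = raising ^ℕ j} {E*ℕ 2} (R^^≋ j) (E*≋ 2)

  LR^^E₂≋ : ∀ j → (L ⊗ ((R ^^ j) ⊗ E* 2)) ≋ ιM (lowerRaise j)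
  LR^^E₂≋ j = ⊗-ιM {M' = lowering} {raising ^ℕ j ⊗ℕ E*ℕ 2} L≋ (R^^E₂≋ j)

  R^^LE₂≋ : ∀ j → ((R ^^ j) ⊗ (L ⊗ E* 2)) ≋ ιM (raising ^ℕ j ⊗ℕ (lowering ⊗ℕ E*ℕ 2))
  R^^LE₂≋ j = ⊗-ιM {M' = raising ^ℕ j} {lowering ⊗ℕ E*ℕ 2} (R^^≋ j) (⊗-ιM {M' = lowering} {E*ℕ 2} L≋ (E*≋ 2))

  sum≋ : ∀ m → sumRange 0 m (λ j → (R ^^ (m ∸ j)) ⊗ (L ⊗ ((R ^^ j) ⊗ E* 2))) ≋ ιM (raising ⊗ℕ partialSum m)
  sum≋ m = ιM-≐ {M' = sumRangeℕ 0 m (λ j → raising ^ℕ (m ∸ j) ⊗ℕ lowerRaise j)}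
    (sumRange-ιM 0 m (λ j → ⊗-ιM {M' = raising ^ℕ (m ∸ j)} {lowerRaise j} (R^^≋ (m ∸ j)) (LR^^E₂≋ j)))
    (sumRangeℕ-pow≐horner raising lowerRaise m)

  module _ (α β : ℕ → Carrier)
           (hyp : ∀ i → 2 ≤ i → i +ℕ 2 ≤ D → ∀ y z → Dist G x y 2 → Dist G x z i → Dist G y z i →
                  α i + β i * ι (count (λ v → inΓ G 1 x v ∧ inΓ G 1 y v ∧ inΓ G (i ∸ 1) z v))
                    ≈ ι (count (λ v → inΓ G (i ∸ 1) x v ∧ inΓ G (i ∸ 1) y v ∧ inΓ G 1 z v)))
           (k : ℕ) (i+2≤D : suc (suc k) +ℕ 2 ≤ D) where
    open RingIdentities cring

    i m : ℕ
    i = suc (suc k)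
    m = suc k

    cᵢ K : Carrier
    cᵢ = ι (cc i)
    K  = (cᵢ * ι (cc m)) * (β i * ι (cc 2) + ι (b i)) + (α i + - cᵢ) * ι (bcSum m)

    entry-identity : ∀ u v →
      α i * (L ⊗ ((R ^^ m) ⊗ E* 2)) u v
        ≈ ((cᵢ + - α i) * sumRange 0 m (λ j → (R ^^ (m ∸ j)) ⊗ (L ⊗ ((R ^^ j) ⊗ E* 2))) u v
           + (- (cᵢ * β i)) * ((R ^^ m) ⊗ (L ⊗ E* 2)) u v)
          + K * ((R ^^ k) ⊗ E* 2) u v
    entry-identity u v =
      trans (*-congˡ (LR^^E₂≋ m u v))
      (trans (by-case classify)
             (sym (+-cong (+-cong (*-congˡ (sum≋ m u v)) (*-congˡ (R^^LE₂≋ m u v))) (*-congˡ (R^^E₂≋ k u v)))))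
      where
      open AtEntry k u v hiding (i; m)
      ι≡ : ∀ {p q} → p ≡.≡ q → ι p ≈ ι q
      ι≡ e = reflexive (≡.cong ι e)
      by-case : EntryCase → α i * ι lrEntry ≈ ((cᵢ + - α i) * ι sumEntry + (- (cᵢ * β i)) * ι rlEntry) + K * ι rEntry
      by-case (distance-i xv xu vu lr rl r sum+lr upper+level) =
        trans (*-congˡ ιlr)
        (trans (identity-at-distance-i (α i) (β i) (ι (cProd m)) (ι upper) (ι lower) (ι level) cᵢ (ι sumEntry)
                  (trans (+-congˡ (sym ιlr)) (trans (sym (ι-+ sumEntry lrEntry)) (trans (ι≡ sum+lr) (ι-* (cProd m) (cc i)))))
                  (trans (sym (ι-+ upper level)) (ι≡ upper+level))
                  (hyp i (s≤s (s≤s z≤n)) i+2≤D v u xv xu vu))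
        (trans (sym (trans (+-congˡ (zeroʳ K)) (+-identityʳ _)))
               (sym (+-cong (+-congˡ (*-congˡ (trans (ι≡ rl) (ι-* (cProd m) lower)))) (*-congˡ (ι≡ r))))))
        where
        ιlr : ι lrEntry ≈ ι (cProd m) * ι upper
        ιlr = trans (ι≡ lr) (ι-* (cProd m) upper)
      by-case (distance-i∸2 lr rl r sum+lr) =
        trans (*-congˡ ιlr)
        (trans (identity-at-distance-i∸2 (α i) (β i) cᵢ (ι (cc m)) (ι (cc 2)) (ι (b i)) (ι (bcSum m)) (ι (cProd k)) (ι (cProd m)) (ι sumEntry)
                  (ι-* (cProd k) (cc m))
                  (trans (+-congˡ (sym ιlr)) (trans (sym (ι-+ sumEntry lrEntry)) (trans (ι≡ sum+lr) (ι-* (cProd k) (bcSum m))))))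
               (sym (+-cong (+-congˡ (*-congˡ (trans (ι≡ rl) (ι-* (cProd m) (cc 2))))) (*-congˡ (ι≡ r)))))
        where
        ιlr : ι lrEntry ≈ ι (cProd m) * ι (b i)
        ιlr = trans (ι≡ lr) (ι-* (cProd m) (b i))
      by-case (vanishing lr rl r sum) =
        trans (*-congˡ (ι≡ lr))
        (trans (solve 4 (λ a p q r → a :* con (+ 0) := (p :* con (+ 0) :+ q :* con (+ 0)) :+ r :* con (+ 0)) refl (α i) (cᵢ + - α i) (- (cᵢ * β i)) K)
               (sym (+-cong (+-cong (*-congˡ (ι≡ sum)) (*-congˡ (ι≡ rl))) (*-congˡ (ι≡ r)))))

corollary7p3 :
  ∀ {c ℓ} (F : CharZeroField c ℓ) {n : ℕ} (G : Graph n) (D k : ℕ) (b cc : ℕ → ℕ) (x : Fin n) →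
  IsDRG G b cc → HasDiameter G D → Regular G k → Bipartite G →
  4 ≤ D → 3 ≤ k →
  let open CharZeroField F
      open Matrices F
      open GraphMats G D x
  in
  (α β : ℕ → Carrier) →
  (∀ i → 2 ≤ i → i +ℕ 2 ≤ D → ∀ y z →
     Dist G x y 2 → Dist G x z i → Dist G y z i →
     α i + β i * ι (count (λ v → inΓ G 1 x v ∧ inΓ G 1 y v ∧ inΓ G (i ∸ 1) z v))
       ≈ ι (count (λ v → inΓ G (i ∸ 1) x v ∧ inΓ G (i ∸ 1) y v ∧ inΓ G 1 z v))) →
  ∀ i → 2 ≤ i → i +ℕ 2 ≤ D →
  (α i · (L ⊗ ((R ^^ (i ∸ 1)) ⊗ E* 2)))
    ≋ ((((ι (cc i) + - α i) ·
           sumRange 0 (i ∸ 1) (λ j → (R ^^ (i ∸ 1 ∸ j)) ⊗ (L ⊗ ((R ^^ j) ⊗ E* 2))))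
        ⊕ ((- (ι (cc i) * β i)) · ((R ^^ (i ∸ 1)) ⊗ (L ⊗ E* 2))))
        ⊕ (((ι (cc i) * ι (cc (i ∸ 1))) * (β i * ι (cc 2) + ι (b i))
             + (α i + - ι (cc i)) * ι (sumℕ (i ∸ 1) (λ j → b j *ℕ cc (suc j))))
           · ((R ^^ (i ∸ 2)) ⊗ E* 2)))
corollary7p3 F G D _ b c x drg diam _ bip _ _ α β hyp (suc (suc k)) _ i+2≤D =
  EntryIdentity.entry-identity F G D b c x drg diam bip α β hyp k i+2≤D
corollary7p3 _ _ _ _ _ _ _ _ _ _ _ _ _ _ _ _ (suc zero) (s≤s ()) _
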